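{- Let $l\ge1$ and $k_1,\dots,k_l\ge1$ be integers, with indices extended cyclically ($k_j=k_{j'}$ whenever $j\equiv j'\pmod l$). Then \[ \sum_{j=1}^{l}(\bar{\rho}_0\circ\alpha\circ d)(z_{k_j}\cdots z_{k_{j+l-1}}) =\sum_{j=1}^{l}\sum_{i=1}^{k_j-1}z_{k_j-i+1}z_{k_{j+1}}\cdots z_{k_{j+l-1}}z_i-(k_1+\cdots+k_l)\,z_{k_1+\cdots+k_l+1}. \]
   Context: Let $\mathfrak{H}=\mathbb{Q}\langle x,y\rangle$ be the noncommutative polynomial algebra over $\mathbb{Q}$ in $x,y$; $z=x+y$, $z_k=x^{k-1}y$. Let $\gamma$ be the algebra automorphism of $\mathfrak{H}$ with $\gamma(x)=x$, $\gamma(y)=z$, and $d$ the $\mathbb{Q}$-linear map on $\mathbb{Q}+\mathfrak{H}y$ with $d(1)=1$, $d(wy)=\gamma(w)y$. Let $\alpha\colon\mathfrak{H}y\to\mathfrak{H}y$ be the $\mathbb{Q}$-linear map $\alpha(z_{k_1'}\cdots z_{k_{l'}'})=\frac{1}{l'}z_{k_1'}\cdots z_{k_{l'}'}$ on monomials (division by depth). Make $\mathfrak{H}\otimes\mathfrak{H}$ an $\mathfrak{H}$-bimodule via $a\diamond(w_1\otimes w_2)\diamond b=w_1b\otimes aw_2$. Let $\bar{\mathcal{C}}_0\colon\mathfrak{H}\to\mathfrak{H}\otimes\mathfrak{H}$ be the $\mathbb{Q}$-linear map with $\bar{\mathcal{C}}_0(1)=0$, $\bar{\mathcal{C}}_0(x)=x\otimes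 y$, $\bar{\mathcal{C}}_0(y)=-x\otimes y$, $\bar{\mathcal{C}}_0(ww')=\bar{\mathcal{C}}_0(w)\diamond\gamma^{ -1}(w')+\gamma^{ -1}(w)\diamond\bar{\mathcal{C}}_0(w')$, and $\bar{\rho}_0=M_0\circ\bar{\mathcal{C}}_0$ with $M_0(w_1\otimes w_2)=w_1w_2$. -}

module Defs where

open import Data.Nat as ℕ using (ℕ; zero; suc; NonZero; _∸_)
open import Data.Nat.DivMod using (_mod_)
import Data.Nat.ListAction
open import Data.Fin using (Fin)
open import Data.Bool using (if_then_else_)
open import Data.List using (List; []; _∷_; _++_; map; concatMap; foldr; reverse; replicate; upTo; [_])
open import Data.List.Properties using (≡-dec)
open import Data.Rational as Q using (ℚ; 0ℚ; 1ℚ)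
open import Data.Integer using (+_)
open import Data.Product using (_×_; _,_)
open import Relation.Nullary using (Dec; yes; no; does)
open import Relation.Binary.PropositionalEquality using (_≡_; refl)

-- Letters and words (monomials of 𝔥 = ℚ⟨x,y⟩)
data Letter : Set where
  x y : Letter

_≟L_ : (a b : Letter) → Dec (a ≡ b)
x ≟L x = yes refl
x ≟L y = no λ ()
y ≟L x = no λ ()
y ≟L y = yes refl

Word : Set
Word = List Letter

_≟W_ : (u v : Word) → Dec (u ≡ v)
_≟W_ = ≡-dec _≟L_

Poly : Set
Poly = List (ℚ × Word)

-- coefficient of a word; two polynomials are equal iff all coefficients agree
coeff : Poly → Word → ℚ
coeff p w = foldr (λ { (c , u) acc → if does (u ≟W w) then c Q.+ acc else acc }) 0ℚ p

infix 4 _≈P_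
_≈P_ : Poly → Poly → Set
p ≈P q = ∀ w → coeff p w ≡ coeff q w

word : Word → Poly
word w = [ (1ℚ , w) ]

infixl 6 _+P_
_+P_ : Poly → Poly → Poly
_+P_ = _++_

scale : ℚ → Poly → Poly
scale c = map (λ { (a , w) → (c Q.* a , w) })

-P_ : Poly → Poly
-P p = scale (Q.- 1ℚ) p

infixl 7 _*P_
_*P_ : Poly → Poly → Poly
p *P q = concatMap (λ { (a , u) → map (λ { (b , v) → (a Q.* b , u ++ v) }) q }) p

linear : (Word → Poly) → Poly → Poly
linear f = concatMap (λ { (c , w) → scale c (f w) })

liftW : (Letter → Poly) → Word → Poly
liftW f [] = word []
liftW f (a ∷ w) = f a *P liftW f w

-- z = x + y, z_k = x^{k-1} y  (k ≥ 1; z 0 is junk and never used)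
zW : ℕ → Word
zW zero = []
zW (suc m) = replicate m x ++ [ y ]

γL : Letter → Poly
γL x = word [ x ]
γL y = word [ x ] +P word [ y ]

γinvL : Letter → Poly
γinvL x = word [ x ]
γinvL y = word [ y ] +P -P word [ x ]

γW : Word → Poly
γW = liftW γL

γinvW : Word → Poly
γinvW = liftW γinvL

-- d(1) = 1, d(w y) = γ(w) y  (words ending in x are outside the domain; sent to 0)
dRev : Word → Poly
dRev [] = word []
dRev (x ∷ r) = []
dRev (y ∷ r) = γW (reverse r) *P word [ y ]

dW : Word → Poly
dW w = dRev (reverse w)

d : Poly → Poly
d = linear dW

depth : Word → ℕ
depth [] = 0
depth (x ∷ w) = depth w
depth (y ∷ w) = suc (depth w)

invDepth : Word → ℚ
invDepth w with depth w
... | zero = 0ℚ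
... | suc m = + 1 Q./ suc m

α : Poly → Poly
α = linear (λ w → scale (invDepth w) (word w))

-- 𝔥 ⊗ 𝔥 : formal combinations of pairs of words
Tens : Set
Tens = List (ℚ × Word × Word)

-- bimodule action  a ◇ (w1 ⊗ w2) ◇ b = w1 b ⊗ a w2, extended bilinearly
actL : Poly → Tens → Tens
actL p t = concatMap (λ { (a , u) → map (λ { (c , w1 , w2) → (a Q.* c , w1 , u ++ w2) }) t }) p

actR : Tens → Poly → Tens
actR t p = concatMap (λ { (b , v) → map (λ { (c , w1 , w2) → (b Q.* c , w1 ++ v , w2) }) t }) p

CL : Letter → Tens
CL x = [ (1ℚ , [ x ] , [ y ]) ]
CL y = [ (Q.- 1ℚ , [ x ] , [ y ]) ]

C0W : Word → Tens
C0W [] = []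
C0W (a ∷ w) = actR (CL a) (γinvW w) ++ actL (γinvL a) (C0W w)

M0 : Tens → Poly
M0 = map (λ { (c , w1 , w2) → (c , w1 ++ w2) })

ρ0 : Poly → Poly
ρ0 = linear (λ w → M0 (C0W w))

Σ[_] : {A : Set} → List A → (A → Poly) → Poly
Σ[ xs ] f = concatMap f xs

cyc : (l : ℕ) .{{_ : NonZero l}} → (Fin l → ℕ) → ℕ → ℕ
cyc l k j = k (j mod l)

zs : (ℕ → ℕ) → ℕ → ℕ → Word
zs kc a n = concatMap (λ m → zW (kc (a ℕ.+ m))) (upTo n)

sumFin : (l : ℕ) → (Fin l → ℕ) → ℕ
sumFin l k = Data.Nat.ListAction.sum (map k (Data.List.allFin l))

-- Polynomials are compared through their pairings ⟪ p ∣ F ⟫ with arbitrary test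
-- functions F : Word → ℚ (an indicator function recovers a coefficient), so every
-- linear map is replaced by its transpose acting on test functions.
--
-- The transpose of ρ̄₀ is invariant under rotating words: the bimodule action puts
-- γ⁻¹ of the left factor on the right, so the two terms of the Leibniz rule for C̄₀
-- on u v and on v u agree after multiplication.  Since d(w z_k) = γ(w) z_k, the
-- l rotations of W = z_{k_1} ⋯ z_{k_l} then sum to ρ̄₀ α applied to γ(W) weighted
-- by depth: depth is additive, and on each block γ(z_k) = x^k + z_k only z_k has
-- non-zero depth.  Weighting α by depth leaves the identity minus the projection
-- onto depth 0, and the only depth-0 word in γ(W) is x^K, with ρ̄₀(x^K) = K z_{K+1}.
-- Finally ρ̄₀(γ(w)) is the sum of x v u y over the factorisations w = u x v; grouping
-- the letters x of W by blocks gives the double sum.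
module Submission where

open import Defs
open import Data.Nat as ℕ using (ℕ; zero; suc; _∸_; NonZero; _≤_; _+_)
open import Data.List as L using (List; []; _∷_; _++_; map; concatMap; replicate; reverse; upTo; applyUpTo; [_]; length)
open import Data.List.Properties as LP using (++-assoc; ++-identityʳ)
import Data.Rational
open import Data.Rational as Q using (ℚ; 0ℚ; 1ℚ; toℚᵘ; -_)
open import Data.Integer as ℤ using (+_)
import Data.Integer.Properties as ZP
import Data.Rational.Unnormalised as U
import Data.Rational.Unnormalised.Properties as UP
import Data.Nat.Properties as NP
import Data.Rational.Properties as QP
open import Data.Fin as Fin using (Fin; toℕ)
import Data.Fin.Properties as FP
open import Data.Nat.DivMod using ([m+n]%n≡m%n; m<n⇒m%n≡m; m%n<n)
open import Data.Nat.ListAction using (sum)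
open import Function using (_∘_; id)
open import Data.Product using (_,_)
open import Relation.Binary.PropositionalEquality hiding ([_])
open import Tactic.RingSolver
import Data.Integer.Tactic.RingSolver as ℤ-Solver
open import Tactic.RingSolver.Core.AlmostCommutativeRing
open import Data.Maybe using (Maybe; just; nothing)
open import Relation.Nullary using (yes; no; does)
open import Data.Bool using (true; false; if_then_else_)

open ≡-Reasoning

ℚ-ring : AlmostCommutativeRing _ _
ℚ-ring = fromCommutativeRing QP.+-*-commutativeRing isZero?
  where
  isZero? : ∀ q → Maybe (0ℚ ≡ q)
  isZero? q with 0ℚ Q.≟ q
  ... | yes p = just p
  ... | no _ = nothing

*-distribˡ-over-cons : ∀ a c b e → (a Q.* c) Q.* b Q.+ a Q.* e ≡ a Q.* (c Q.* b Q.+ e)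
*-distribˡ-over-cons = solve-∀ ℚ-ring

⟪_∣_⟫ : Poly → (Word → ℚ) → ℚ
⟪ [] ∣ F ⟫ = 0ℚ
⟪ (c , u) ∷ p ∣ F ⟫ = c Q.* F u Q.+ ⟪ p ∣ F ⟫

⟪_∣_⟫₂ : Tens → (Word → Word → ℚ) → ℚ
⟪ [] ∣ H ⟫₂ = 0ℚ
⟪ (c , w₁ , w₂) ∷ t ∣ H ⟫₂ = c Q.* H w₁ w₂ Q.+ ⟪ t ∣ H ⟫₂

pair-cong : ∀ p {F G : Word → ℚ} → (∀ u → F u ≡ G u) → ⟪ p ∣ F ⟫ ≡ ⟪ p ∣ G ⟫
pair-cong [] e = refl
pair-cong ((c , u) ∷ p) e = cong₂ (λ a b → c Q.* a Q.+ b) (e u) (pair-cong p e)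

pair₂-cong : ∀ t {H H′ : Word → Word → ℚ} → (∀ u v → H u v ≡ H′ u v) → ⟪ t ∣ H ⟫₂ ≡ ⟪ t ∣ H′ ⟫₂
pair₂-cong [] e = refl
pair₂-cong ((c , u , v) ∷ t) e = cong₂ (λ a b → c Q.* a Q.+ b) (e u v) (pair₂-cong t e)

pair-++ : ∀ p q F → ⟪ p ++ q ∣ F ⟫ ≡ ⟪ p ∣ F ⟫ Q.+ ⟪ q ∣ F ⟫
pair-++ [] q F = sym (QP.+-identityˡ _)
pair-++ ((c , u) ∷ p) q F =
  trans (cong (c Q.* F u Q.+_) (pair-++ p q F)) (sym (QP.+-assoc (c Q.* F u) ⟪ p ∣ F ⟫ ⟪ q ∣ F ⟫))

pair₂-++ : ∀ s t H → ⟪ s ++ t ∣ H ⟫₂ ≡ ⟪ s ∣ H ⟫₂ Q.+ ⟪ t ∣ H ⟫₂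
pair₂-++ [] t H = sym (QP.+-identityˡ _)
pair₂-++ ((c , u , v) ∷ s) t H =
  trans (cong (c Q.* H u v Q.+_) (pair₂-++ s t H)) (sym (QP.+-assoc (c Q.* H u v) ⟪ s ∣ H ⟫₂ ⟪ t ∣ H ⟫₂))

pair-zero : ∀ p → ⟪ p ∣ (λ _ → 0ℚ) ⟫ ≡ 0ℚ
pair-zero [] = refl
pair-zero ((c , u) ∷ p) = cong₂ Q._+_ (QP.*-zeroʳ c) (pair-zero p)

pair-+ : ∀ p F G → ⟪ p ∣ (λ u → F u Q.+ G u) ⟫ ≡ ⟪ p ∣ F ⟫ Q.+ ⟪ p ∣ G ⟫
pair-+ [] F G = refl
pair-+ ((c , u) ∷ p) F G =
  trans (cong (c Q.* (F u Q.+ G u) Q.+_) (pair-+ p F G)) (shuffle c (F u) (G u) ⟪ p ∣ F ⟫ ⟪ p ∣ G ⟫)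
  where
  shuffle : ∀ a b e f g → a Q.* (b Q.+ e) Q.+ (f Q.+ g) ≡ (a Q.* b Q.+ f) Q.+ (a Q.* e Q.+ g)
  shuffle = solve-∀ ℚ-ring

pair-* : ∀ p a F → ⟪ p ∣ (λ u → a Q.* F u) ⟫ ≡ a Q.* ⟪ p ∣ F ⟫
pair-* [] a F = sym (QP.*-zeroʳ a)
pair-* ((c , u) ∷ p) a F =
  trans (cong (c Q.* (a Q.* F u) Q.+_) (pair-* p a F)) (shuffle c a (F u) ⟪ p ∣ F ⟫)
  where
  shuffle : ∀ c a b e → c Q.* (a Q.* b) Q.+ a Q.* e ≡ a Q.* (c Q.* b Q.+ e)
  shuffle = solve-∀ ℚ-ring

pair-scale : ∀ a p F → ⟪ scale a p ∣ F ⟫ ≡ a Q.* ⟪ p ∣ F ⟫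
pair-scale a [] F = sym (QP.*-zeroʳ a)
pair-scale a ((c , u) ∷ p) F =
  trans (cong ((a Q.* c) Q.* F u Q.+_) (pair-scale a p F)) (*-distribˡ-over-cons a c (F u) ⟪ p ∣ F ⟫)

pair-word : ∀ u F → ⟪ word u ∣ F ⟫ ≡ F u
pair-word u F = trans (QP.+-identityʳ _) (QP.*-identityˡ _)

pair-*P-word : ∀ a u q F → ⟪ [ (a , u) ] *P q ∣ F ⟫ ≡ a Q.* ⟪ q ∣ (λ v → F (u ++ v)) ⟫
pair-*P-word a u [] F = sym (QP.*-zeroʳ a)
pair-*P-word a u ((b , v) ∷ q) F =
  trans (cong ((a Q.* b) Q.* F (u ++ v) Q.+_) (pair-*P-word a u q F)) (*-distribˡ-over-cons a b (F (u ++ v)) _)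

*P-∷ˡ : ∀ a u p q → ((a , u) ∷ p) *P q ≡ [ (a , u) ] *P q ++ p *P q
*P-∷ˡ a u p q = cong (_++ p *P q) (sym (++-identityʳ _))

pair-*P : ∀ p q F → ⟪ p *P q ∣ F ⟫ ≡ ⟪ p ∣ (λ u → ⟪ q ∣ (λ v → F (u ++ v)) ⟫) ⟫
pair-*P [] q F = refl
pair-*P ((a , u) ∷ p) q F = begin
  ⟪ ((a , u) ∷ p) *P q ∣ F ⟫
    ≡⟨ cong ⟪_∣ F ⟫ (*P-∷ˡ a u p q) ⟩
  ⟪ ([ (a , u) ] *P q) ++ (p *P q) ∣ F ⟫
    ≡⟨ pair-++ ([ (a , u) ] *P q) (p *P q) F ⟩
  ⟪ [ (a , u) ] *P q ∣ F ⟫ Q.+ ⟪ p *P q ∣ F ⟫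
    ≡⟨ cong₂ Q._+_ (pair-*P-word a u q F) (pair-*P p q F) ⟩
  a Q.* ⟪ q ∣ (λ v → F (u ++ v)) ⟫ Q.+ ⟪ p ∣ (λ u → ⟪ q ∣ (λ v → F (u ++ v)) ⟫) ⟫ ∎

pair-swap : ∀ p q (G : Word → Word → ℚ) →
  ⟪ p ∣ (λ u → ⟪ q ∣ (λ v → G u v) ⟫) ⟫ ≡ ⟪ q ∣ (λ v → ⟪ p ∣ (λ u → G u v) ⟫) ⟫
pair-swap [] q G = sym (pair-zero q)
pair-swap ((c , u) ∷ p) q G = sym (begin
  ⟪ q ∣ (λ v → c Q.* G u v Q.+ ⟪ p ∣ (λ u → G u v) ⟫) ⟫
    ≡⟨ pair-+ q _ _ ⟩
  ⟪ q ∣ (λ v → c Q.* G u v) ⟫ Q.+ ⟪ q ∣ (λ v → ⟪ p ∣ (λ u → G u v) ⟫) ⟫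
    ≡⟨ cong₂ Q._+_ (pair-* q c (G u)) (sym (pair-swap p q G)) ⟩
  c Q.* ⟪ q ∣ G u ⟫ Q.+ ⟪ p ∣ (λ u → ⟪ q ∣ (λ v → G u v) ⟫) ⟫ ∎)

Σ∈ : {A : Set} → List A → (A → ℚ) → ℚ
Σ∈ [] f = 0ℚ
Σ∈ (e ∷ es) f = f e Q.+ Σ∈ es f

Σ∈-cong : {A : Set} (xs : List A) {f g : A → ℚ} → (∀ e → f e ≡ g e) → Σ∈ xs f ≡ Σ∈ xs g
Σ∈-cong [] e = refl
Σ∈-cong (a ∷ xs) e = cong₂ Q._+_ (e a) (Σ∈-cong xs e)

Σ∈-map : {A B : Set} (f : A → B) (xs : List A) (g : B → ℚ) → Σ∈ (map f xs) g ≡ Σ∈ xs (λ e → g (f e))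
Σ∈-map f [] g = refl
Σ∈-map f (e ∷ xs) g = cong (g (f e) Q.+_) (Σ∈-map f xs g)

pair-concatMap : {A : Set} (g : A → Poly) (xs : List A) (F : Word → ℚ) →
  ⟪ concatMap g xs ∣ F ⟫ ≡ Σ∈ xs (λ e → ⟪ g e ∣ F ⟫)
pair-concatMap g [] F = refl
pair-concatMap g (e ∷ xs) F =
  trans (pair-++ (g e) (concatMap g xs) F) (cong (⟪ g e ∣ F ⟫ Q.+_) (pair-concatMap g xs F))

pair-linear : ∀ f p F → ⟪ linear f p ∣ F ⟫ ≡ ⟪ p ∣ (λ u → ⟪ f u ∣ F ⟫) ⟫
pair-linear f [] F = refl
pair-linear f ((c , w) ∷ p) F =
  trans (pair-++ (scale c (f w)) (linear f p) F) (cong₂ Q._+_ (pair-scale c (f w) F) (pair-linear f p F))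

pair-M0 : ∀ t F → ⟪ M0 t ∣ F ⟫ ≡ ⟪ t ∣ (λ w₁ w₂ → F (w₁ ++ w₂)) ⟫₂
pair-M0 [] F = refl
pair-M0 ((c , w₁ , w₂) ∷ t) F = cong (c Q.* F (w₁ ++ w₂) Q.+_) (pair-M0 t F)

pair₂-actL-word : ∀ a u t H → ⟪ actL [ (a , u) ] t ∣ H ⟫₂ ≡ a Q.* ⟪ t ∣ (λ w₁ w₂ → H w₁ (u ++ w₂)) ⟫₂
pair₂-actL-word a u [] H = sym (QP.*-zeroʳ a)
pair₂-actL-word a u ((c , w₁ , w₂) ∷ t) H =
  trans (cong ((a Q.* c) Q.* H w₁ (u ++ w₂) Q.+_) (pair₂-actL-word a u t H)) (*-distribˡ-over-cons a c _ _)

actL-∷ : ∀ a u p t → actL ((a , u) ∷ p) t ≡ actL [ (a , u) ] t ++ actL p t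
actL-∷ a u p t = cong (_++ actL p t) (sym (++-identityʳ _))

pair₂-actL : ∀ p t H → ⟪ actL p t ∣ H ⟫₂ ≡ ⟪ p ∣ (λ u → ⟪ t ∣ (λ w₁ w₂ → H w₁ (u ++ w₂)) ⟫₂) ⟫
pair₂-actL [] t H = refl
pair₂-actL ((a , u) ∷ p) t H =
  trans (cong ⟪_∣ H ⟫₂ (actL-∷ a u p t))
  (trans (pair₂-++ (actL [ (a , u) ] t) (actL p t) H)
         (cong₂ Q._+_ (pair₂-actL-word a u t H) (pair₂-actL p t H)))

pair₂-actR-word : ∀ t a u H → ⟪ actR t [ (a , u) ] ∣ H ⟫₂ ≡ a Q.* ⟪ t ∣ (λ w₁ w₂ → H (w₁ ++ u) w₂) ⟫₂
pair₂-actR-word [] a u H = sym (QP.*-zeroʳ a)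
pair₂-actR-word ((c , w₁ , w₂) ∷ t) a u H =
  trans (cong ((a Q.* c) Q.* H (w₁ ++ u) w₂ Q.+_) (pair₂-actR-word t a u H)) (*-distribˡ-over-cons a c _ _)

actR-∷ : ∀ t a u p → actR t ((a , u) ∷ p) ≡ actR t [ (a , u) ] ++ actR t p
actR-∷ t a u p = cong (_++ actR t p) (sym (++-identityʳ _))

pair₂-actR : ∀ t p H → ⟪ actR t p ∣ H ⟫₂ ≡ ⟪ p ∣ (λ u → ⟪ t ∣ (λ w₁ w₂ → H (w₁ ++ u) w₂) ⟫₂) ⟫
pair₂-actR t [] H = refl
pair₂-actR t ((a , u) ∷ p) H =
  trans (cong ⟪_∣ H ⟫₂ (actR-∷ t a u p))
  (trans (pair₂-++ (actR t [ (a , u) ]) (actR t p) H)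
         (cong₂ Q._+_ (pair₂-actR-word t a u H) (pair₂-actR t p H)))

δ : Word → Word → ℚ
δ w u = if does (u ≟W w) then 1ℚ else 0ℚ

coeff≡pair-δ : ∀ p w → coeff p w ≡ ⟪ p ∣ δ w ⟫
coeff≡pair-δ [] w = refl
coeff≡pair-δ ((c , u) ∷ p) w with does (u ≟W w)
... | true = cong₂ Q._+_ (sym (QP.*-identityʳ c)) (coeff≡pair-δ p w)
... | false = trans (coeff≡pair-δ p w) (sym (trans (cong (Q._+ ⟪ p ∣ δ w ⟫) (QP.*-zeroʳ c)) (QP.+-identityˡ _)))

≈P-by-pairing : ∀ {p q} → (∀ F → ⟪ p ∣ F ⟫ ≡ ⟪ q ∣ F ⟫) → p ≈P q
≈P-by-pairing {p} {q} eq w = trans (coeff≡pair-δ p w) (trans (eq (δ w)) (sym (coeff≡pair-δ q w)))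

pair-liftW-++ : ∀ f u v G →
  ⟪ liftW f (u ++ v) ∣ G ⟫ ≡ ⟪ liftW f u ∣ (λ r₁ → ⟪ liftW f v ∣ (λ r₂ → G (r₁ ++ r₂)) ⟫) ⟫
pair-liftW-++ f [] v G = sym (pair-word [] (λ r₁ → ⟪ liftW f v ∣ (λ r₂ → G (r₁ ++ r₂)) ⟫))
pair-liftW-++ f (a ∷ u) v G = begin
  ⟪ f a *P liftW f (u ++ v) ∣ G ⟫
    ≡⟨ pair-*P (f a) _ G ⟩
  ⟪ f a ∣ (λ s → ⟪ liftW f (u ++ v) ∣ (λ t → G (s ++ t)) ⟫) ⟫
    ≡⟨ pair-cong (f a) (λ s → pair-liftW-++ f u v (λ t → G (s ++ t))) ⟩
  ⟪ f a ∣ (λ s → ⟪ liftW f u ∣ (λ r₁ → ⟪ liftW f v ∣ (λ r₂ → G (s ++ (r₁ ++ r₂))) ⟫) ⟫) ⟫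
    ≡⟨ pair-cong (f a) (λ s → pair-cong (liftW f u) (λ r₁ → pair-cong (liftW f v) (λ r₂ →
         cong G (sym (++-assoc s r₁ r₂))))) ⟩
  ⟪ f a ∣ (λ s → ⟪ liftW f u ∣ (λ r₁ → ⟪ liftW f v ∣ (λ r₂ → G ((s ++ r₁) ++ r₂)) ⟫) ⟫) ⟫
    ≡⟨ sym (pair-*P (f a) (liftW f u) _) ⟩
  ⟪ f a *P liftW f u ∣ (λ r₁ → ⟪ liftW f v ∣ (λ r₂ → G (r₁ ++ r₂)) ⟫) ⟫ ∎

pair-γ⁻¹-letter : ∀ c G → ⟪ γinvW [ c ] ∣ G ⟫ ≡ ⟪ γinvL c ∣ G ⟫
pair-γ⁻¹-letter c G =
  trans (pair-*P (γinvL c) (word []) G)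
        (pair-cong (γinvL c) (λ s → trans (pair-word [] (λ t → G (s ++ t))) (cong G (++-identityʳ s))))

pair-γ⁻¹∘γ-letter : ∀ a G → ⟪ γL a ∣ (λ u → ⟪ γinvW u ∣ G ⟫) ⟫ ≡ G [ a ]
pair-γ⁻¹∘γ-letter x G =
  trans (pair-word [ x ] (λ u → ⟪ γinvW u ∣ G ⟫)) (trans (pair-γ⁻¹-letter x G) (pair-word [ x ] G))
pair-γ⁻¹∘γ-letter y G = begin
  1ℚ Q.* ⟪ γinvW [ x ] ∣ G ⟫ Q.+ (1ℚ Q.* ⟪ γinvW [ y ] ∣ G ⟫ Q.+ 0ℚ)
    ≡⟨ cong₂ (λ p q → 1ℚ Q.* p Q.+ (1ℚ Q.* q Q.+ 0ℚ))
             (trans (pair-γ⁻¹-letter x G) (pair-word [ x ] G)) (pair-γ⁻¹-letter y G) ⟩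
  1ℚ Q.* G [ x ] Q.+ (1ℚ Q.* (1ℚ Q.* G [ y ] Q.+ ((Q.- 1ℚ Q.* 1ℚ) Q.* G [ x ] Q.+ 0ℚ)) Q.+ 0ℚ)
    ≡⟨ x+[y-x]≡y (G [ x ]) (G [ y ]) ⟩
  G [ y ] ∎
  where
  x+[y-x]≡y : ∀ a b → 1ℚ Q.* a Q.+ (1ℚ Q.* (1ℚ Q.* b Q.+ ((Q.- 1ℚ Q.* 1ℚ) Q.* a Q.+ 0ℚ)) Q.+ 0ℚ) ≡ b
  x+[y-x]≡y = solve-∀ ℚ-ring

pair-γ⁻¹∘γ : ∀ w G → ⟪ γW w ∣ (λ v → ⟪ γinvW v ∣ G ⟫) ⟫ ≡ G w
pair-γ⁻¹∘γ [] G = trans (pair-word [] (λ v → ⟪ γinvW v ∣ G ⟫)) (pair-word [] G)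
pair-γ⁻¹∘γ (a ∷ w) G = begin
  ⟪ γL a *P γW w ∣ (λ v → ⟪ γinvW v ∣ G ⟫) ⟫
    ≡⟨ pair-*P (γL a) (γW w) _ ⟩
  ⟪ γL a ∣ (λ u → ⟪ γW w ∣ (λ v → ⟪ γinvW (u ++ v) ∣ G ⟫) ⟫) ⟫
    ≡⟨ pair-cong (γL a) (λ u → pair-cong (γW w) (λ v → pair-liftW-++ γinvL u v G)) ⟩
  ⟪ γL a ∣ (λ u → ⟪ γW w ∣ (λ v → ⟪ γinvW u ∣ (λ r₁ → ⟪ γinvW v ∣ (λ r₂ → G (r₁ ++ r₂)) ⟫) ⟫) ⟫) ⟫
    ≡⟨ pair-cong (γL a) (λ u → pair-swap (γW w) (γinvW u) (λ v r₁ → ⟪ γinvW v ∣ (λ r₂ → G (r₁ ++ r₂)) ⟫)) ⟩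
  ⟪ γL a ∣ (λ u → ⟪ γinvW u ∣ (λ r₁ → ⟪ γW w ∣ (λ v → ⟪ γinvW v ∣ (λ r₂ → G (r₁ ++ r₂)) ⟫) ⟫) ⟫) ⟫
    ≡⟨ pair-cong (γL a) (λ u → pair-cong (γinvW u) (λ r₁ → pair-γ⁻¹∘γ w (λ r₂ → G (r₁ ++ r₂)))) ⟩
  ⟪ γL a ∣ (λ u → ⟪ γinvW u ∣ (λ r₁ → G (r₁ ++ w)) ⟫) ⟫
    ≡⟨ pair-γ⁻¹∘γ-letter a (λ r₁ → G (r₁ ++ w)) ⟩
  G (a ∷ w) ∎

pair-γ-xⁿ : ∀ n G → ⟪ γW (replicate n x) ∣ G ⟫ ≡ G (replicate n x)
pair-γ-xⁿ zero G = pair-word [] G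
pair-γ-xⁿ (suc n) G =
  trans (pair-*P (word [ x ]) (γW (replicate n x)) G)
  (trans (pair-word [ x ] (λ u → ⟪ γW (replicate n x) ∣ (λ v → G (u ++ v)) ⟫))
         (pair-γ-xⁿ n (λ v → G (x ∷ v))))

CL-sign : Letter → ℚ
CL-sign x = 1ℚ
CL-sign y = Q.- 1ℚ

pair₂-CL : ∀ a H → ⟪ CL a ∣ H ⟫₂ ≡ CL-sign a Q.* H [ x ] [ y ]
pair₂-CL x H = QP.+-identityʳ _
pair₂-CL y H = QP.+-identityʳ _

⟪C̄₀_∣_⟫ : Word → (Word → Word → ℚ) → ℚ
⟪C̄₀ w ∣ H ⟫ = ⟪ C0W w ∣ H ⟫₂

pairC̄₀-cong : ∀ w {H H′ : Word → Word → ℚ} → (∀ u v → H u v ≡ H′ u v) → ⟪C̄₀ w ∣ H ⟫ ≡ ⟪C̄₀ w ∣ H′ ⟫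
pairC̄₀-cong w = pair₂-cong (C0W w)

pairC̄₀-∷ : ∀ a w H → ⟪C̄₀ a ∷ w ∣ H ⟫ ≡
  ⟪ γinvW w ∣ (λ r → CL-sign a Q.* H (x ∷ r) [ y ]) ⟫ Q.+
  ⟪ γinvL a ∣ (λ u → ⟪C̄₀ w ∣ (λ w₁ w₂ → H w₁ (u ++ w₂)) ⟫) ⟫
pairC̄₀-∷ a w H = begin
  ⟪ actR (CL a) (γinvW w) ++ actL (γinvL a) (C0W w) ∣ H ⟫₂
    ≡⟨ pair₂-++ (actR (CL a) (γinvW w)) _ H ⟩
  ⟪ actR (CL a) (γinvW w) ∣ H ⟫₂ Q.+ ⟪ actL (γinvL a) (C0W w) ∣ H ⟫₂
    ≡⟨ cong₂ Q._+_ (trans (pair₂-actR (CL a) (γinvW w) H) (pair-cong (γinvW w) (λ r → pair₂-CL a _)))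
                   (pair₂-actL (γinvL a) (C0W w) H) ⟩
  ⟪ γinvW w ∣ (λ r → CL-sign a Q.* H (x ∷ r) [ y ]) ⟫ Q.+
  ⟪ γinvL a ∣ (λ u → ⟪C̄₀ w ∣ (λ w₁ w₂ → H w₁ (u ++ w₂)) ⟫) ⟫ ∎

pairC̄₀-++ : ∀ w v H → ⟪C̄₀ w ++ v ∣ H ⟫ ≡
  ⟪ γinvW v ∣ (λ r → ⟪C̄₀ w ∣ (λ w₁ w₂ → H (w₁ ++ r) w₂) ⟫) ⟫ Q.+
  ⟪ γinvW w ∣ (λ r → ⟪C̄₀ v ∣ (λ w₁ w₂ → H w₁ (r ++ w₂)) ⟫) ⟫
pairC̄₀-++ [] v H =
  sym (trans (cong₂ Q._+_ (pair-zero (γinvW v)) (pair-word [] (λ r → ⟪C̄₀ v ∣ (λ w₁ w₂ → H w₁ (r ++ w₂)) ⟫)))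
             (QP.+-identityˡ _))
pairC̄₀-++ (a ∷ w) v H = begin
  ⟪C̄₀ a ∷ (w ++ v) ∣ H ⟫
    ≡⟨ pairC̄₀-∷ a (w ++ v) H ⟩
  ⟪ γinvW (w ++ v) ∣ S ⟫ Q.+ ⟪ γinvL a ∣ (λ u → ⟪C̄₀ w ++ v ∣ Hᵘ u ⟫) ⟫
    ≡⟨ cong₂ Q._+_ (pair-liftW-++ γinvL w v S) (pair-cong (γinvL a) (λ u → pairC̄₀-++ w v (Hᵘ u))) ⟩
  T Q.+ ⟪ γinvL a ∣ (λ u → A u Q.+ B u) ⟫
    ≡⟨ cong (T Q.+_) (pair-+ (γinvL a) A B) ⟩
  T Q.+ (⟪ γinvL a ∣ A ⟫ Q.+ ⟪ γinvL a ∣ B ⟫)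
    ≡⟨ cong₂ (λ p q → p Q.+ (q Q.+ ⟪ γinvL a ∣ B ⟫))
             (pair-swap (γinvW w) (γinvW v) (λ r₁ r₂ → S (r₁ ++ r₂)))
             (pair-swap (γinvL a) (γinvW v) (λ u r → ⟪C̄₀ w ∣ (λ w₁ w₂ → H (w₁ ++ r) (u ++ w₂)) ⟫)) ⟩
  R₁ Q.+ (R₂ Q.+ ⟪ γinvL a ∣ B ⟫)
    ≡⟨ cong (λ q → R₁ Q.+ (R₂ Q.+ q)) (pair-cong (γinvL a) (λ u → pair-cong (γinvW w) (λ r →
         pairC̄₀-cong v (λ w₁ w₂ → cong (H w₁) (sym (++-assoc u r w₂)))))) ⟩
  R₁ Q.+ (R₂ Q.+ R₃)
    ≡⟨ sym (QP.+-assoc R₁ R₂ R₃) ⟩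
  (R₁ Q.+ R₂) Q.+ R₃
    ≡⟨ cong₂ Q._+_ (sym (trans (pair-cong (γinvW v) (λ r → pairC̄₀-∷ a w (λ w₁ w₂ → H (w₁ ++ r) w₂)))
                               (pair-+ (γinvW v) _ _)))
                   (sym (pair-*P (γinvL a) (γinvW w) _)) ⟩
  ⟪ γinvW v ∣ (λ r → ⟪C̄₀ a ∷ w ∣ (λ w₁ w₂ → H (w₁ ++ r) w₂) ⟫) ⟫ Q.+
  ⟪ γinvW (a ∷ w) ∣ (λ r → ⟪C̄₀ v ∣ (λ w₁ w₂ → H w₁ (r ++ w₂)) ⟫) ⟫ ∎
  where
  S : Word → ℚ
  S r = CL-sign a Q.* H (x ∷ r) [ y ]
  Hᵘ : Word → Word → Word → ℚ
  Hᵘ u w₁ w₂ = H w₁ (u ++ w₂)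
  A B : Word → ℚ
  A u = ⟪ γinvW v ∣ (λ r → ⟪C̄₀ w ∣ (λ w₁ w₂ → H (w₁ ++ r) (u ++ w₂)) ⟫) ⟫
  B u = ⟪ γinvW w ∣ (λ r → ⟪C̄₀ v ∣ (λ w₁ w₂ → H w₁ (u ++ (r ++ w₂))) ⟫) ⟫
  T R₁ R₂ R₃ : ℚ
  T = ⟪ γinvW w ∣ (λ r₁ → ⟪ γinvW v ∣ (λ r₂ → S (r₁ ++ r₂)) ⟫) ⟫
  R₁ = ⟪ γinvW v ∣ (λ r → ⟪ γinvW w ∣ (λ r′ → S (r′ ++ r)) ⟫) ⟫
  R₂ = ⟪ γinvW v ∣ (λ r → ⟪ γinvL a ∣ (λ u → ⟪C̄₀ w ∣ (λ w₁ w₂ → H (w₁ ++ r) (u ++ w₂)) ⟫) ⟫) ⟫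
  R₃ = ⟪ γinvL a ∣ (λ u → ⟪ γinvW w ∣ (λ r → ⟪C̄₀ v ∣ (λ w₁ w₂ → H w₁ ((u ++ r) ++ w₂)) ⟫) ⟫) ⟫

ρ0ᵀ : (Word → ℚ) → Word → ℚ
ρ0ᵀ F t = ⟪C̄₀ t ∣ (λ w₁ w₂ → F (w₁ ++ w₂)) ⟫

ρ0ᵀ-rotate : ∀ F u v → ρ0ᵀ F (u ++ v) ≡ ρ0ᵀ F (v ++ u)
ρ0ᵀ-rotate F u v = begin
  ρ0ᵀ F (u ++ v)
    ≡⟨ pairC̄₀-++ u v _ ⟩
  X₁ Q.+ X₂
    ≡⟨ QP.+-comm X₁ X₂ ⟩
  X₂ Q.+ X₁
    ≡⟨ cong₂ Q._+_ (pair-cong (γinvW u) (λ r → pairC̄₀-cong v (λ w₁ w₂ → cong F (sym (++-assoc w₁ r w₂)))))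
                   (pair-cong (γinvW v) (λ r → pairC̄₀-cong u (λ w₁ w₂ → cong F (++-assoc w₁ r w₂)))) ⟩
  _ ≡⟨ sym (pairC̄₀-++ v u _) ⟩
  ρ0ᵀ F (v ++ u) ∎
  where
  X₁ X₂ : ℚ
  X₁ = ⟪ γinvW v ∣ (λ r → ⟪C̄₀ u ∣ (λ w₁ w₂ → F ((w₁ ++ r) ++ w₂)) ⟫) ⟫
  X₂ = ⟪ γinvW u ∣ (λ r → ⟪C̄₀ v ∣ (λ w₁ w₂ → F (w₁ ++ (r ++ w₂))) ⟫) ⟫

-- xCuts w H is the sum of H (x v) (u y) over all factorisations w = u x v.
xCuts : Word → (Word → Word → ℚ) → ℚ
xCuts [] H = 0ℚ
xCuts (x ∷ w) H = H (x ∷ w) [ y ] Q.+ xCuts w (λ w₁ w₂ → H w₁ (x ∷ w₂))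
xCuts (y ∷ w) H = xCuts w (λ w₁ w₂ → H w₁ (y ∷ w₂))

xCuts-cong : ∀ w {H H′ : Word → Word → ℚ} → (∀ u v → H u v ≡ H′ u v) → xCuts w H ≡ xCuts w H′
xCuts-cong [] e = refl
xCuts-cong (x ∷ w) e = cong₂ Q._+_ (e _ _) (xCuts-cong w (λ u v → e u (x ∷ v)))
xCuts-cong (y ∷ w) e = xCuts-cong w (λ u v → e u (y ∷ v))

pair-γ-C̄₀-x∷ : ∀ w H → ⟪ γW w ∣ (λ v → ⟪C̄₀ x ∷ v ∣ H ⟫) ⟫
                       ≡ H (x ∷ w) [ y ] Q.+ ⟪ γW w ∣ (λ v → ⟪C̄₀ v ∣ (λ w₁ w₂ → H w₁ (x ∷ w₂)) ⟫) ⟫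
pair-γ-C̄₀-x∷ w H = begin
  ⟪ γW w ∣ (λ v → ⟪C̄₀ x ∷ v ∣ H ⟫) ⟫
    ≡⟨ pair-cong (γW w) (λ v → trans (pairC̄₀-∷ x v H)
         (cong (⟪ γinvW v ∣ S ⟫ Q.+_) (pair-word [ x ] (λ u → ⟪C̄₀ v ∣ (λ w₁ w₂ → H w₁ (u ++ w₂)) ⟫)))) ⟩
  ⟪ γW w ∣ (λ v → ⟪ γinvW v ∣ S ⟫ Q.+ ⟪C̄₀ v ∣ (λ w₁ w₂ → H w₁ (x ∷ w₂)) ⟫) ⟫
    ≡⟨ pair-+ (γW w) _ _ ⟩
  ⟪ γW w ∣ (λ v → ⟪ γinvW v ∣ S ⟫) ⟫ Q.+ ⟪ γW w ∣ (λ v → ⟪C̄₀ v ∣ (λ w₁ w₂ → H w₁ (x ∷ w₂)) ⟫) ⟫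
    ≡⟨ cong (Q._+ ⟪ γW w ∣ (λ v → ⟪C̄₀ v ∣ (λ w₁ w₂ → H w₁ (x ∷ w₂)) ⟫) ⟫)
            (trans (pair-γ⁻¹∘γ w S) (QP.*-identityˡ (H (x ∷ w) [ y ]))) ⟩
  H (x ∷ w) [ y ] Q.+ ⟪ γW w ∣ (λ v → ⟪C̄₀ v ∣ (λ w₁ w₂ → H w₁ (x ∷ w₂)) ⟫) ⟫ ∎
  where
  S : Word → ℚ
  S r = CL-sign x Q.* H (x ∷ r) [ y ]

pair-linear-combination : ∀ p a b f g →
  ⟪ p ∣ (λ v → a Q.* f v Q.+ (b Q.* g v Q.+ 0ℚ)) ⟫ ≡ a Q.* ⟪ p ∣ f ⟫ Q.+ (b Q.* ⟪ p ∣ g ⟫ Q.+ 0ℚ)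
pair-linear-combination p a b f g = begin
  ⟪ p ∣ (λ v → a Q.* f v Q.+ (b Q.* g v Q.+ 0ℚ)) ⟫
    ≡⟨ pair-+ p _ _ ⟩
  ⟪ p ∣ (λ v → a Q.* f v) ⟫ Q.+ ⟪ p ∣ (λ v → b Q.* g v Q.+ 0ℚ) ⟫
    ≡⟨ cong₂ Q._+_ (pair-* p a f) (pair-+ p (λ v → b Q.* g v) (λ _ → 0ℚ)) ⟩
  a Q.* ⟪ p ∣ f ⟫ Q.+ (⟪ p ∣ (λ v → b Q.* g v) ⟫ Q.+ ⟪ p ∣ (λ _ → 0ℚ) ⟫)
    ≡⟨ cong₂ (λ s t → a Q.* ⟪ p ∣ f ⟫ Q.+ (s Q.+ t)) (pair-* p b g) (pair-zero p) ⟩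
  a Q.* ⟪ p ∣ f ⟫ Q.+ (b Q.* ⟪ p ∣ g ⟫ Q.+ 0ℚ) ∎

pair-γ-C̄₀ : ∀ w H → ⟪ γW w ∣ (λ t → ⟪C̄₀ t ∣ H ⟫) ⟫ ≡ xCuts w H
pair-γ-C̄₀ [] H = pair-word [] (λ t → ⟪C̄₀ t ∣ H ⟫)
pair-γ-C̄₀ (x ∷ w) H = begin
  ⟪ γW (x ∷ w) ∣ (λ t → ⟪C̄₀ t ∣ H ⟫) ⟫
    ≡⟨ pair-*P (word [ x ]) (γW w) _ ⟩
  ⟪ word [ x ] ∣ (λ u → ⟪ γW w ∣ (λ v → ⟪C̄₀ u ++ v ∣ H ⟫) ⟫) ⟫
    ≡⟨ pair-word [ x ] (λ u → ⟪ γW w ∣ (λ v → ⟪C̄₀ u ++ v ∣ H ⟫) ⟫) ⟩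
  ⟪ γW w ∣ (λ v → ⟪C̄₀ x ∷ v ∣ H ⟫) ⟫
    ≡⟨ pair-γ-C̄₀-x∷ w H ⟩
  H (x ∷ w) [ y ] Q.+ ⟪ γW w ∣ (λ v → ⟪C̄₀ v ∣ (λ w₁ w₂ → H w₁ (x ∷ w₂)) ⟫) ⟫
    ≡⟨ cong (H (x ∷ w) [ y ] Q.+_) (pair-γ-C̄₀ w _) ⟩
  xCuts (x ∷ w) H ∎
-- γ(y) = x + y, and the leading terms ±H (x w) y of C̄₀(x ⋯) and C̄₀(y ⋯) cancel.
pair-γ-C̄₀ (y ∷ w) H = begin
  ⟪ γW (y ∷ w) ∣ (λ t → ⟪C̄₀ t ∣ H ⟫) ⟫
    ≡⟨ pair-*P (γL y) (γW w) _ ⟩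
  1ℚ Q.* Kx Q.+ (1ℚ Q.* Ky Q.+ 0ℚ)
    ≡⟨ cong₂ (λ p q → 1ℚ Q.* p Q.+ (1ℚ Q.* q Q.+ 0ℚ)) (pair-γ-C̄₀-x∷ w H) Ky-expand ⟩
  1ℚ Q.* (h Q.+ Bx) Q.+ (1ℚ Q.* (Q.- 1ℚ Q.* h Q.+ (1ℚ Q.* By Q.+ ((Q.- 1ℚ Q.* 1ℚ) Q.* Bx Q.+ 0ℚ))) Q.+ 0ℚ)
    ≡⟨ cancel h Bx By ⟩
  By
    ≡⟨ pair-γ-C̄₀ w _ ⟩
  xCuts (y ∷ w) H ∎
  where
  Kx Ky h Bx By : ℚ
  Kx = ⟪ γW w ∣ (λ v → ⟪C̄₀ x ∷ v ∣ H ⟫) ⟫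
  Ky = ⟪ γW w ∣ (λ v → ⟪C̄₀ y ∷ v ∣ H ⟫) ⟫
  h = H (x ∷ w) [ y ]
  Bx = ⟪ γW w ∣ (λ v → ⟪C̄₀ v ∣ (λ w₁ w₂ → H w₁ (x ∷ w₂)) ⟫) ⟫
  By = ⟪ γW w ∣ (λ v → ⟪C̄₀ v ∣ (λ w₁ w₂ → H w₁ (y ∷ w₂)) ⟫) ⟫
  S : Word → ℚ
  S r = CL-sign y Q.* H (x ∷ r) [ y ]
  Ky-expand : Ky ≡ Q.- 1ℚ Q.* h Q.+ (1ℚ Q.* By Q.+ ((Q.- 1ℚ Q.* 1ℚ) Q.* Bx Q.+ 0ℚ))
  Ky-expand = begin
    Ky
      ≡⟨ pair-cong (γW w) (λ v → pairC̄₀-∷ y v H) ⟩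
    ⟪ γW w ∣ (λ v → ⟪ γinvW v ∣ S ⟫ Q.+ ⟪ γinvL y ∣ (λ u → ⟪C̄₀ v ∣ (λ w₁ w₂ → H w₁ (u ++ w₂)) ⟫) ⟫) ⟫
      ≡⟨ pair-+ (γW w) _ _ ⟩
    ⟪ γW w ∣ (λ v → ⟪ γinvW v ∣ S ⟫) ⟫ Q.+
    ⟪ γW w ∣ (λ v → ⟪ γinvL y ∣ (λ u → ⟪C̄₀ v ∣ (λ w₁ w₂ → H w₁ (u ++ w₂)) ⟫) ⟫) ⟫
      ≡⟨ cong₂ Q._+_ (pair-γ⁻¹∘γ w S)
           (pair-linear-combination (γW w) 1ℚ (Q.- 1ℚ Q.* 1ℚ)
             (λ v → ⟪C̄₀ v ∣ (λ w₁ w₂ → H w₁ (y ∷ w₂)) ⟫)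
             (λ v → ⟪C̄₀ v ∣ (λ w₁ w₂ → H w₁ (x ∷ w₂)) ⟫)) ⟩
    Q.- 1ℚ Q.* h Q.+ (1ℚ Q.* By Q.+ ((Q.- 1ℚ Q.* 1ℚ) Q.* Bx Q.+ 0ℚ)) ∎
  cancel : ∀ h a b → 1ℚ Q.* (h Q.+ a) Q.+ (1ℚ Q.* (Q.- 1ℚ Q.* h Q.+ (1ℚ Q.* b Q.+ ((Q.- 1ℚ Q.* 1ℚ) Q.* a Q.+ 0ℚ))) Q.+ 0ℚ) ≡ b
  cancel = solve-∀ ℚ-ring

fromℕ : ℕ → ℚ
fromℕ n = + n Q./ 1

fromℕ-+ : ∀ m n → fromℕ (m + n) ≡ fromℕ m Q.+ fromℕ n
fromℕ-+ m n = QP.toℚᵘ-injective (UP.≃-trans (toℚᵘ-fromℕ (m + n)) (UP.≃-trans unnormalised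
  (UP.≃-sym (UP.≃-trans (QP.toℚᵘ-homo-+ (fromℕ m) (fromℕ n)) (UP.+-cong (toℚᵘ-fromℕ m) (toℚᵘ-fromℕ n))))))
  where
  toℚᵘ-fromℕ : ∀ n → toℚᵘ (fromℕ n) U.≃ U.mkℚᵘ (+ n) 0
  toℚᵘ-fromℕ n = QP.toℚᵘ-fromℚᵘ (U.mkℚᵘ (+ n) 0)
  unnormalised : U.mkℚᵘ (+ (m + n)) 0 U.≃ (U.mkℚᵘ (+ m) 0 U.+ U.mkℚᵘ (+ n) 0)
  unnormalised = U.*≡* (trans (cong (ℤ._* (+ 1 ℤ.* + 1)) (ZP.pos-+ m n)) (normalise (+ m) (+ n)))
    where
    normalise : ∀ a b → (a ℤ.+ b) ℤ.* (+ 1 ℤ.* + 1) ≡ (a ℤ.* + 1 ℤ.+ b ℤ.* + 1) ℤ.* + 1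
    normalise = ℤ-Solver.solve-∀

fromℕ-suc-*-recip : ∀ m → fromℕ (suc m) Q.* (+ 1 Q./ suc m) ≡ 1ℚ
fromℕ-suc-*-recip m = QP.toℚᵘ-injective (UP.≃-trans (QP.toℚᵘ-homo-* (fromℕ (suc m)) (+ 1 Q./ suc m))
  (UP.≃-trans (UP.*-cong (QP.toℚᵘ-fromℚᵘ (U.mkℚᵘ (+ suc m) 0)) (QP.toℚᵘ-fromℚᵘ (U.mkℚᵘ (+ 1) m)))
              (U.*≡* (normalise (+ m)))))
  where
  normalise : ∀ a → (+ 1 ℤ.+ a) ℤ.* + 1 ℤ.* + 1 ≡ + 1 ℤ.* (+ 1 ℤ.* (+ 1 ℤ.+ a))
  normalise = ℤ-Solver.solve-∀

depth-++ : ∀ u v → depth (u ++ v) ≡ depth u + depth v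
depth-++ [] v = refl
depth-++ (x ∷ u) v = depth-++ u v
depth-++ (y ∷ u) v = cong suc (depth-++ u v)

recip : ℕ → ℚ
recip zero = 0ℚ
recip (suc m) = + 1 Q./ suc m

invDepth≡recip-depth : ∀ w → invDepth w ≡ recip (depth w)
invDepth≡recip-depth w with depth w
... | zero = refl
... | suc m = refl

invDepth-rotate : ∀ u v → invDepth (u ++ v) ≡ invDepth (v ++ u)
invDepth-rotate u v = begin
  invDepth (u ++ v)           ≡⟨ invDepth≡recip-depth (u ++ v) ⟩
  recip (depth (u ++ v))      ≡⟨ cong recip (depth-++ u v) ⟩
  recip (depth u + depth v)   ≡⟨ cong recip (NP.+-comm (depth u) (depth v)) ⟩
  recip (depth v + depth u)   ≡⟨ cong recip (sym (depth-++ v u)) ⟩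
  recip (depth (v ++ u))      ≡⟨ sym (invDepth≡recip-depth (v ++ u)) ⟩
  invDepth (v ++ u) ∎

isZero : ℕ → ℚ
isZero zero = 1ℚ
isZero (suc _) = 0ℚ

depthZero : Word → ℚ
depthZero w = isZero (depth w)

depth*invDepth : ∀ w a → fromℕ (depth w) Q.* (invDepth w Q.* a) ≡ a Q.+ Q.- 1ℚ Q.* (depthZero w Q.* a)
depth*invDepth w a rewrite invDepth≡recip-depth w with depth w
... | zero = 0≡a-a a
  where
  0≡a-a : ∀ a → 0ℚ Q.* (0ℚ Q.* a) ≡ a Q.+ Q.- 1ℚ Q.* (1ℚ Q.* a)
  0≡a-a = solve-∀ ℚ-ring
... | suc m = begin
  fromℕ (suc m) Q.* ((+ 1 Q./ suc m) Q.* a) ≡⟨ sym (QP.*-assoc (fromℕ (suc m)) _ a) ⟩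
  (fromℕ (suc m) Q.* (+ 1 Q./ suc m)) Q.* a ≡⟨ cong (Q._* a) (fromℕ-suc-*-recip m) ⟩
  1ℚ Q.* a                                  ≡⟨ 1a≡a-0 a ⟩
  a Q.+ Q.- 1ℚ Q.* (0ℚ Q.* a) ∎
  where
  1a≡a-0 : ∀ a → 1ℚ Q.* a ≡ a Q.+ Q.- 1ℚ Q.* (0ℚ Q.* a)
  1a≡a-0 = solve-∀ ℚ-ring

pair-α : ∀ p G → ⟪ α p ∣ G ⟫ ≡ ⟪ p ∣ (λ u → invDepth u Q.* G u) ⟫
pair-α p G = trans (pair-linear (λ w → scale (invDepth w) (word w)) p G)
  (pair-cong p (λ u → trans (pair-scale (invDepth u) (word u) G) (cong (invDepth u Q.*_) (pair-word u G))))

pair-ρ0 : ∀ p F → ⟪ ρ0 p ∣ F ⟫ ≡ ⟪ p ∣ ρ0ᵀ F ⟫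
pair-ρ0 p F = trans (pair-linear (λ w → M0 (C0W w)) p F) (pair-cong p (λ u → pair-M0 (C0W u) F))

pair-d-word : ∀ w G → ⟪ d (word w) ∣ G ⟫ ≡ ⟪ dW w ∣ G ⟫
pair-d-word w G = trans (pair-linear dW (word w) G) (pair-word w (λ u → ⟪ dW u ∣ G ⟫))

pair-dW-∷ʳy : ∀ s G → ⟪ dW (s ++ [ y ]) ∣ G ⟫ ≡ ⟪ γW s ∣ (λ v → G (v ++ [ y ])) ⟫
pair-dW-∷ʳy s G = begin
  ⟪ dRev (reverse (s ++ [ y ])) ∣ G ⟫
    ≡⟨ cong (λ r → ⟪ dRev r ∣ G ⟫) (LP.reverse-++ s [ y ]) ⟩
  ⟪ γW (reverse (reverse s)) *P word [ y ] ∣ G ⟫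
    ≡⟨ cong (λ r → ⟪ γW r *P word [ y ] ∣ G ⟫) (LP.reverse-involutive s) ⟩
  ⟪ γW s *P word [ y ] ∣ G ⟫
    ≡⟨ pair-*P (γW s) (word [ y ]) G ⟩
  ⟪ γW s ∣ (λ u → ⟪ word [ y ] ∣ (λ v → G (u ++ v)) ⟫) ⟫
    ≡⟨ pair-cong (γW s) (λ u → pair-word [ y ] (λ v → G (u ++ v))) ⟩
  ⟪ γW s ∣ (λ v → G (v ++ [ y ])) ⟫ ∎

pair-dW-z : ∀ s k → .{{NonZero k}} → (G : Word → ℚ) → ⟪ dW (s ++ zW k) ∣ G ⟫ ≡ ⟪ γW s ∣ (λ v → G (v ++ zW k)) ⟫
pair-dW-z s (suc m) G = begin
  ⟪ dW (s ++ (replicate m x ++ [ y ])) ∣ G ⟫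
    ≡⟨ cong (λ w → ⟪ dW w ∣ G ⟫) (sym (++-assoc s (replicate m x) [ y ])) ⟩
  ⟪ dW ((s ++ replicate m x) ++ [ y ]) ∣ G ⟫
    ≡⟨ pair-dW-∷ʳy (s ++ replicate m x) G ⟩
  ⟪ γW (s ++ replicate m x) ∣ (λ v → G (v ++ [ y ])) ⟫
    ≡⟨ pair-liftW-++ γL s (replicate m x) (λ v → G (v ++ [ y ])) ⟩
  ⟪ γW s ∣ (λ r₁ → ⟪ γW (replicate m x) ∣ (λ r₂ → G ((r₁ ++ r₂) ++ [ y ])) ⟫) ⟫
    ≡⟨ pair-cong (γW s) (λ r₁ → trans (pair-γ-xⁿ m (λ r₂ → G ((r₁ ++ r₂) ++ [ y ])))
                                      (cong G (++-assoc r₁ (replicate m x) [ y ]))) ⟩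
  ⟪ γW s ∣ (λ v → G (v ++ (replicate m x ++ [ y ]))) ⟫ ∎

pair-γ-depthZero : ∀ w G → ⟪ γW w ∣ (λ u → depthZero u Q.* G u) ⟫ ≡ G (replicate (length w) x)
pair-γ-depthZero [] G = trans (pair-word [] (λ u → depthZero u Q.* G u)) (QP.*-identityˡ (G []))
pair-γ-depthZero (x ∷ w) G =
  trans (pair-*P (word [ x ]) (γW w) _)
  (trans (pair-word [ x ] (λ u → ⟪ γW w ∣ (λ v → depthZero (u ++ v) Q.* G (u ++ v)) ⟫))
         (pair-γ-depthZero w (λ v → G (x ∷ v))))
pair-γ-depthZero (y ∷ w) G = begin
  ⟪ γL y *P γW w ∣ (λ u → depthZero u Q.* G u) ⟫
    ≡⟨ pair-*P (γL y) (γW w) _ ⟩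
  1ℚ Q.* ⟪ γW w ∣ (λ v → depthZero v Q.* G (x ∷ v)) ⟫ Q.+ (1ℚ Q.* ⟪ γW w ∣ (λ v → 0ℚ Q.* G (y ∷ v)) ⟫ Q.+ 0ℚ)
    ≡⟨ cong₂ (λ p q → 1ℚ Q.* p Q.+ (1ℚ Q.* q Q.+ 0ℚ)) (pair-γ-depthZero w (λ v → G (x ∷ v)))
             (trans (pair-* (γW w) 0ℚ (λ v → G (y ∷ v))) (QP.*-zeroˡ ⟪ γW w ∣ (λ v → G (y ∷ v)) ⟫)) ⟩
  1ℚ Q.* G (x ∷ replicate (length w) x) Q.+ (1ℚ Q.* 0ℚ Q.+ 0ℚ)
    ≡⟨ 1a+[1·0+0]≡a _ ⟩
  G (replicate (length (y ∷ w)) x) ∎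
  where
  1a+[1·0+0]≡a : ∀ a → 1ℚ Q.* a Q.+ (1ℚ Q.* 0ℚ Q.+ 0ℚ) ≡ a
  1a+[1·0+0]≡a = solve-∀ ℚ-ring

pair-γ-z-depth : ∀ k → .{{NonZero k}} → (G : Word → ℚ) → ⟪ γW (zW k) ∣ (λ u → fromℕ (depth u) Q.* G u) ⟫ ≡ G (zW k)
pair-γ-z-depth (suc zero) G = depth-weights (G [ x ]) (G [ y ])
  where
  depth-weights : ∀ a b → (1ℚ Q.* 1ℚ) Q.* (0ℚ Q.* a) Q.+ ((1ℚ Q.* 1ℚ) Q.* (1ℚ Q.* b) Q.+ 0ℚ) ≡ b
  depth-weights = solve-∀ ℚ-ring
pair-γ-z-depth (suc (suc m)) G =
  trans (pair-*P (word [ x ]) (γW (zW (suc m))) _)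
  (trans (pair-word [ x ] (λ u → ⟪ γW (zW (suc m)) ∣ (λ v → fromℕ (depth (u ++ v)) Q.* G (u ++ v)) ⟫))
         (pair-γ-z-depth (suc m) (λ v → G (x ∷ v))))

ρ0αᵀ : (Word → ℚ) → Word → ℚ
ρ0αᵀ F u = invDepth u Q.* ρ0ᵀ F u

ρ0αᵀ-rotate : ∀ F u v → ρ0αᵀ F (u ++ v) ≡ ρ0αᵀ F (v ++ u)
ρ0αᵀ-rotate F u v = cong₂ Q._*_ (invDepth-rotate u v) (ρ0ᵀ-rotate F u v)

zs-suc : ∀ κ a n → zs κ a (suc n) ≡ zW (κ a) ++ zs κ (suc a) n
zs-suc κ a n = cong₂ _++_ (cong (zW ∘ κ) (NP.+-identityʳ a)) (begin
  concatMap f (applyUpTo suc n)   ≡⟨ cong (concatMap f) (sym (LP.map-upTo suc n)) ⟩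
  concatMap f (map suc (upTo n))  ≡⟨ LP.concatMap-map f suc (upTo n) ⟩
  concatMap (f ∘ suc) (upTo n)    ≡⟨ LP.concatMap-cong (λ m → cong (zW ∘ κ) (NP.+-suc a m)) (upTo n) ⟩
  zs κ (suc a) n ∎)
  where
  f : ℕ → Word
  f m = zW (κ (a + m))

zs-+ : ∀ κ a m r → zs κ a (m + r) ≡ zs κ a m ++ zs κ (a + m) r
zs-+ κ a zero r = cong (λ b → zs κ b r) (sym (NP.+-identityʳ a))
zs-+ κ a (suc m) r = begin
  zs κ a (suc (m + r))
    ≡⟨ zs-suc κ a (m + r) ⟩
  zW (κ a) ++ zs κ (suc a) (m + r)
    ≡⟨ cong (zW (κ a) ++_) (zs-+ κ (suc a) m r) ⟩
  zW (κ a) ++ (zs κ (suc a) m ++ zs κ (suc a + m) r)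
    ≡⟨ sym (++-assoc (zW (κ a)) _ _) ⟩
  (zW (κ a) ++ zs κ (suc a) m) ++ zs κ (suc (a + m)) r
    ≡⟨ cong₂ _++_ (sym (zs-suc κ a m)) (cong (λ b → zs κ b r) (sym (NP.+-suc a m))) ⟩
  zs κ a (suc m) ++ zs κ (a + suc m) r ∎

zs-∷ʳ : ∀ κ a n → zs κ a (suc n) ≡ zs κ a n ++ zW (κ (a + n))
zs-∷ʳ κ a n = begin
  zs κ a (suc n)                     ≡⟨ cong (zs κ a) (NP.+-comm 1 n) ⟩
  zs κ a (n + 1)                         ≡⟨ zs-+ κ a n 1 ⟩
  zs κ a n ++ zW (κ (a + n + 0)) ++ []   ≡⟨ cong (zs κ a n ++_) (++-identityʳ _) ⟩
  zs κ a n ++ zW (κ (a + n + 0))         ≡⟨ cong (λ t → zs κ a n ++ zW (κ t)) (NP.+-identityʳ (a + n)) ⟩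
  zs κ a n ++ zW (κ (a + n)) ∎

zs-periodic : ∀ κ l → (∀ n → κ (n + l) ≡ κ n) → ∀ a r → zs κ (a + l) r ≡ zs κ a r
zs-periodic κ l periodic a r = LP.concatMap-cong (λ i → cong zW (begin
  κ (a + l + i)   ≡⟨ cong κ (NP.+-assoc a l i) ⟩
  κ (a + (l + i)) ≡⟨ cong (λ t → κ (a + t)) (NP.+-comm l i) ⟩
  κ (a + (i + l)) ≡⟨ cong κ (sym (NP.+-assoc a i l)) ⟩
  κ (a + i + l)   ≡⟨ periodic (a + i) ⟩
  κ (a + i) ∎)) (upTo r)

length-zW : ∀ k → length (zW k) ≡ k
length-zW zero = refl
length-zW (suc m) = trans (LP.length-++ (replicate m x)) (trans (cong (_+ 1) (LP.length-replicate m)) (NP.+-comm m 1))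

length-concatMap : {A B : Set} (f : A → List B) (xs : List A) → length (concatMap f xs) ≡ sum (map (length ∘ f) xs)
length-concatMap f [] = refl
length-concatMap f (a ∷ xs) = trans (LP.length-++ (f a)) (cong (length (f a) ℕ.+_) (length-concatMap f xs))

tabulate≡applyUpTo : ∀ n (g : Fin n → ℕ) (h : ℕ → ℕ) → (∀ i → g i ≡ h (toℕ i)) → L.tabulate g ≡ applyUpTo h n
tabulate≡applyUpTo zero g h e = refl
tabulate≡applyUpTo (suc n) g h e =
  cong₂ _∷_ (e Fin.zero) (tabulate≡applyUpTo n (g ∘ Fin.suc) (h ∘ suc) (e ∘ Fin.suc))

cyc-toℕ : ∀ l .{{_ : NonZero l}} (k : Fin l → ℕ) (i : Fin l) → k i ≡ cyc l k (toℕ i)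
cyc-toℕ l k i = cong k (sym (FP.toℕ-injective (trans (FP.toℕ-fromℕ< _) (m<n⇒m%n≡m (FP.toℕ<n i)))))

cyc-periodic : ∀ l .{{_ : NonZero l}} (k : Fin l → ℕ) n → cyc l k (n + l) ≡ cyc l k n
cyc-periodic l k n = cong k (FP.fromℕ<-cong _ _ ([m+n]%n≡m%n n l) (m%n<n (n + l) l) (m%n<n n l))

length-zs-cyc : ∀ l .{{_ : NonZero l}} (k : Fin l → ℕ) → length (zs (cyc l k) 0 l) ≡ sumFin l k
length-zs-cyc l k = begin
  length (zs κ 0 l)                      ≡⟨ length-concatMap (zW ∘ κ) (upTo l) ⟩
  sum (map (length ∘ zW ∘ κ) (upTo l))   ≡⟨ cong sum (LP.map-cong (length-zW ∘ κ) (upTo l)) ⟩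
  sum (map κ (upTo l))                   ≡⟨ cong sum (LP.map-upTo κ l) ⟩
  sum (applyUpTo κ l)                    ≡⟨ cong sum (sym (tabulate≡applyUpTo l k κ (cyc-toℕ l k))) ⟩
  sum (L.tabulate k)                     ≡⟨ cong sum (sym (LP.map-tabulate id k)) ⟩
  sumFin l k ∎
  where
  κ : ℕ → ℕ
  κ = cyc l k

Σ< : ℕ → (ℕ → ℚ) → ℚ
Σ< zero f = 0ℚ
Σ< (suc n) f = f 0 Q.+ Σ< n (f ∘ suc)

Σ<-cong : ∀ n {f g : ℕ → ℚ} → (∀ i → i ℕ.< n → f i ≡ g i) → Σ< n f ≡ Σ< n g
Σ<-cong zero e = refl
Σ<-cong (suc n) e = cong₂ Q._+_ (e 0 (ℕ.s≤s ℕ.z≤n)) (Σ<-cong n (λ i i<n → e (suc i) (ℕ.s≤s i<n)))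

Σ∈-applyUpTo : ∀ f n (g : ℕ → ℚ) → Σ∈ (applyUpTo f n) g ≡ Σ< n (g ∘ f)
Σ∈-applyUpTo f zero g = refl
Σ∈-applyUpTo f (suc n) g = cong (g (f 0) Q.+_) (Σ∈-applyUpTo (f ∘ suc) n g)

Σ<-∷ʳ : ∀ n f → Σ< (suc n) f ≡ Σ< n f Q.+ f n
Σ<-∷ʳ zero f = QP.+-comm (f 0) 0ℚ
Σ<-∷ʳ (suc n) f = trans (cong (f 0 Q.+_) (Σ<-∷ʳ n (f ∘ suc))) (sym (QP.+-assoc (f 0) _ _))

Σ<-shift : ∀ n f → f n ≡ f 0 → Σ< n (f ∘ suc) ≡ Σ< n f
Σ<-shift n f fn≡f0 = begin
  S                               ≡⟨ b≡[a+b]-a (f 0) S ⟩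
  (f 0 Q.+ S) Q.+ Q.- f 0         ≡⟨ cong (Q._+ Q.- f 0) (Σ<-∷ʳ n f) ⟩
  (Σ< n f Q.+ f n) Q.+ Q.- f 0    ≡⟨ cong (λ t → (Σ< n f Q.+ t) Q.+ Q.- f 0) fn≡f0 ⟩
  (Σ< n f Q.+ f 0) Q.+ Q.- f 0    ≡⟨ sym (b≡[b+a]-a (f 0) (Σ< n f)) ⟩
  Σ< n f ∎
  where
  S : ℚ
  S = Σ< n (f ∘ suc)
  b≡[a+b]-a : ∀ a b → b ≡ (a Q.+ b) Q.+ Q.- a
  b≡[a+b]-a = solve-∀ ℚ-ring
  b≡[b+a]-a : ∀ a b → b ≡ (b Q.+ a) Q.+ Q.- a
  b≡[b+a]-a = solve-∀ ℚ-ring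

Σfocus : (ℕ → ℕ) → ℕ → ℕ → (ℕ → Word → Word → ℚ) → ℚ
Σfocus κ a zero Θ = 0ℚ
Σfocus κ a (suc n) Θ = Θ a [] (zs κ (suc a) n) Q.+ Σfocus κ (suc a) n (λ i pre suf → Θ i (zW (κ a) ++ pre) suf)

Σfocus-cong : ∀ κ a n {Θ Θ′ : ℕ → Word → Word → ℚ} →
  (∀ i pre suf → Θ i pre suf ≡ Θ′ i pre suf) → Σfocus κ a n Θ ≡ Σfocus κ a n Θ′
Σfocus-cong κ a zero e = refl
Σfocus-cong κ a (suc n) e = cong₂ Q._+_ (e _ _ _) (Σfocus-cong κ (suc a) n (λ i pre suf → e i _ suf))

pair-Σfocus : ∀ κ p a n (Θ : Word → ℕ → Word → Word → ℚ) →
  ⟪ p ∣ (λ u → Σfocus κ a n (Θ u)) ⟫ ≡ Σfocus κ a n (λ i pre suf → ⟪ p ∣ (λ u → Θ u i pre suf) ⟫)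
pair-Σfocus κ p a zero Θ = pair-zero p
pair-Σfocus κ p a (suc n) Θ = trans (pair-+ p _ _) (cong (⟪ p ∣ (λ u → Θ u a [] (zs κ (suc a) n)) ⟫ Q.+_)
  (pair-Σfocus κ p (suc a) n (λ u i pre suf → Θ u i (zW (κ a) ++ pre) suf)))

Σfocus≡Σ< : ∀ κ a n Θ → Σfocus κ a n Θ ≡ Σ< n (λ i → Θ (a + i) (zs κ a i) (zs κ (suc (a + i)) (n ∸ suc i)))
Σfocus≡Σ< κ a zero Θ = refl
Σfocus≡Σ< κ a (suc n) Θ = cong₂ Q._+_ head (trans (Σfocus≡Σ< κ (suc a) n _) (Σ<-cong n (λ i _ → tail i)))
  where
  head : Θ a [] (zs κ (suc a) n) ≡ Θ (a + 0) [] (zs κ (suc (a + 0)) n)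
  head = cong (λ b → Θ b [] (zs κ (suc b) n)) (sym (NP.+-identityʳ a))
  tail : ∀ i → Θ (suc a + i) (zW (κ a) ++ zs κ (suc a) i) (zs κ (suc (suc a + i)) (n ∸ suc i))
             ≡ Θ (a + suc i) (zs κ a (suc i)) (zs κ (suc (a + suc i)) (n ∸ suc i))
  tail i = cong₂ (λ b w → Θ b w (zs κ (suc b) (n ∸ suc i))) (sym (NP.+-suc a i)) (sym (zs-suc κ a i))

aroundγ : (ℕ → ℕ) → (Word → ℚ) → ℕ → Word → Word → ℚ
aroundγ κ G i pre suf = ⟪ γW pre ∣ (λ u₁ → ⟪ γW suf ∣ (λ u₂ → G (u₁ ++ (zW (κ i) ++ u₂))) ⟫) ⟫

depth-weight-++ : ∀ (G : Word → ℚ) u v →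
  fromℕ (depth (u ++ v)) Q.* G (u ++ v) ≡ fromℕ (depth u) Q.* G (u ++ v) Q.+ fromℕ (depth v) Q.* G (u ++ v)
depth-weight-++ G u v = begin
  fromℕ (depth (u ++ v)) Q.* G (u ++ v)
    ≡⟨ cong (λ t → fromℕ t Q.* G (u ++ v)) (depth-++ u v) ⟩
  fromℕ (depth u + depth v) Q.* G (u ++ v)
    ≡⟨ cong (Q._* G (u ++ v)) (fromℕ-+ (depth u) (depth v)) ⟩
  (fromℕ (depth u) Q.+ fromℕ (depth v)) Q.* G (u ++ v)
    ≡⟨ QP.*-distribʳ-+ (G (u ++ v)) (fromℕ (depth u)) (fromℕ (depth v)) ⟩
  fromℕ (depth u) Q.* G (u ++ v) Q.+ fromℕ (depth v) Q.* G (u ++ v) ∎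

pair-γ-depth-zs : ∀ κ → (∀ n → NonZero (κ n)) → ∀ a n G →
  ⟪ γW (zs κ a n) ∣ (λ u → fromℕ (depth u) Q.* G u) ⟫ ≡ Σfocus κ a n (aroundγ κ G)
pair-γ-depth-zs κ κ≢0 a zero G = trans (pair-word [] (λ u → fromℕ (depth u) Q.* G u)) (QP.*-zeroˡ (G []))
pair-γ-depth-zs κ κ≢0 a (suc n) G = begin
  ⟪ γW (zs κ a (suc n)) ∣ DG ⟫
    ≡⟨ cong (λ w → ⟪ γW w ∣ DG ⟫) (zs-suc κ a n) ⟩
  ⟪ γW (B ++ r) ∣ DG ⟫
    ≡⟨ pair-liftW-++ γL B r DG ⟩
  ⟪ γW B ∣ (λ u₁ → ⟪ γW r ∣ (λ u₂ → DG (u₁ ++ u₂)) ⟫) ⟫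
    ≡⟨ pair-cong (γW B) (λ u₁ → trans (pair-cong (γW r) (depth-weight-++ G u₁)) (pair-+ (γW r) _ _)) ⟩
  ⟪ γW B ∣ (λ u₁ → ⟪ γW r ∣ (λ u₂ → fromℕ (depth u₁) Q.* G (u₁ ++ u₂)) ⟫ Q.+
                   ⟪ γW r ∣ (λ u₂ → fromℕ (depth u₂) Q.* G (u₁ ++ u₂)) ⟫) ⟫
    ≡⟨ pair-+ (γW B) _ _ ⟩
  ⟪ γW B ∣ (λ u₁ → ⟪ γW r ∣ (λ u₂ → fromℕ (depth u₁) Q.* G (u₁ ++ u₂)) ⟫) ⟫ Q.+
  ⟪ γW B ∣ (λ u₁ → ⟪ γW r ∣ (λ u₂ → fromℕ (depth u₂) Q.* G (u₁ ++ u₂)) ⟫) ⟫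
    ≡⟨ cong₂ Q._+_ focus-on-B focus-in-r ⟩
  aroundγ κ G a [] r Q.+ Σfocus κ (suc a) n (λ i pre suf → aroundγ κ G i (B ++ pre) suf) ∎
  where
  B r : Word
  B = zW (κ a)
  r = zs κ (suc a) n
  DG : Word → ℚ
  DG u = fromℕ (depth u) Q.* G u
  focus-on-B : ⟪ γW B ∣ (λ u₁ → ⟪ γW r ∣ (λ u₂ → fromℕ (depth u₁) Q.* G (u₁ ++ u₂)) ⟫) ⟫ ≡ aroundγ κ G a [] r
  focus-on-B = begin
    ⟪ γW B ∣ (λ u₁ → ⟪ γW r ∣ (λ u₂ → fromℕ (depth u₁) Q.* G (u₁ ++ u₂)) ⟫) ⟫
      ≡⟨ pair-cong (γW B) (λ u₁ → pair-* (γW r) (fromℕ (depth u₁)) (λ u₂ → G (u₁ ++ u₂))) ⟩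
    ⟪ γW B ∣ (λ u₁ → fromℕ (depth u₁) Q.* ⟪ γW r ∣ (λ u₂ → G (u₁ ++ u₂)) ⟫) ⟫
      ≡⟨ pair-γ-z-depth (κ a) {{κ≢0 a}} (λ u → ⟪ γW r ∣ (λ u₂ → G (u ++ u₂)) ⟫) ⟩
    ⟪ γW r ∣ (λ u₂ → G (B ++ u₂)) ⟫
      ≡⟨ sym (pair-word [] (λ u₁ → ⟪ γW r ∣ (λ u₂ → G (u₁ ++ (B ++ u₂))) ⟫)) ⟩
    aroundγ κ G a [] r ∎
  focus-in-r : ⟪ γW B ∣ (λ u₁ → ⟪ γW r ∣ (λ u₂ → fromℕ (depth u₂) Q.* G (u₁ ++ u₂)) ⟫) ⟫
             ≡ Σfocus κ (suc a) n (λ i pre suf → aroundγ κ G i (B ++ pre) suf)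
  focus-in-r = begin
    ⟪ γW B ∣ (λ u₁ → ⟪ γW r ∣ (λ u₂ → fromℕ (depth u₂) Q.* G (u₁ ++ u₂)) ⟫) ⟫
      ≡⟨ pair-cong (γW B) (λ u₁ → pair-γ-depth-zs κ κ≢0 (suc a) n (λ u → G (u₁ ++ u))) ⟩
    ⟪ γW B ∣ (λ u₁ → Σfocus κ (suc a) n (aroundγ κ (λ u → G (u₁ ++ u)))) ⟫
      ≡⟨ pair-Σfocus κ (γW B) (suc a) n _ ⟩
    Σfocus κ (suc a) n (λ i pre suf → ⟪ γW B ∣ (λ u₁ → aroundγ κ (λ u → G (u₁ ++ u)) i pre suf) ⟫)
      ≡⟨ Σfocus-cong κ (suc a) n (λ i pre suf → sym (trans (pair-liftW-++ γL B pre _)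
           (pair-cong (γW B) (λ r₁ → pair-cong (γW pre) (λ r₂ → pair-cong (γW suf) (λ u₂ →
             cong G (++-assoc r₁ r₂ _))))))) ⟩
    Σfocus κ (suc a) n (λ i pre suf → aroundγ κ G i (B ++ pre) suf) ∎

xCuts-++ : ∀ u v H → xCuts (u ++ v) H ≡ xCuts u (λ w₁ w₂ → H (w₁ ++ v) w₂) Q.+ xCuts v (λ w₁ w₂ → H w₁ (u ++ w₂))
xCuts-++ [] v H = sym (QP.+-identityˡ (xCuts v H))
xCuts-++ (x ∷ u) v H =
  trans (cong (H (x ∷ u ++ v) [ y ] Q.+_) (xCuts-++ u v _))
        (sym (QP.+-assoc (H (x ∷ u ++ v) [ y ]) (xCuts u (λ w₁ w₂ → H (w₁ ++ v) (x ∷ w₂)))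
                         (xCuts v (λ w₁ w₂ → H w₁ (x ∷ u ++ w₂)))))
xCuts-++ (y ∷ u) v H = xCuts-++ u v _

aroundCuts : (ℕ → ℕ) → (Word → Word → ℚ) → ℕ → Word → Word → ℚ
aroundCuts κ H i pre suf = xCuts (zW (κ i)) (λ w₁ w₂ → H (w₁ ++ suf) (pre ++ w₂))

xCuts-zs : ∀ κ a n H → xCuts (zs κ a n) H ≡ Σfocus κ a n (aroundCuts κ H)
xCuts-zs κ a zero H = refl
xCuts-zs κ a (suc n) H = begin
  xCuts (zs κ a (suc n)) H
    ≡⟨ cong (λ w → xCuts w H) (zs-suc κ a n) ⟩
  xCuts (zW (κ a) ++ zs κ (suc a) n) H
    ≡⟨ xCuts-++ (zW (κ a)) (zs κ (suc a) n) H ⟩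
  aroundCuts κ H a [] (zs κ (suc a) n) Q.+ xCuts (zs κ (suc a) n) (λ w₁ w₂ → H w₁ (zW (κ a) ++ w₂))
    ≡⟨ cong (aroundCuts κ H a [] (zs κ (suc a) n) Q.+_) (trans (xCuts-zs κ (suc a) n _) (Σfocus-cong κ (suc a) n
         (λ i pre suf → xCuts-cong (zW (κ i)) (λ w₁ w₂ → cong (H (w₁ ++ suf)) (sym (++-assoc (zW (κ a)) pre w₂)))))) ⟩
  Σfocus κ a (suc n) (aroundCuts κ H) ∎

replicate-x-∷ : ∀ q (w : Word) → replicate q x ++ (x ∷ w) ≡ x ∷ (replicate q x ++ w)
replicate-x-∷ zero w = refl
replicate-x-∷ (suc q) w = cong (x ∷_) (replicate-x-∷ q w)

replicate-x-+ : ∀ n p → replicate (n + p) x ≡ replicate n x ++ replicate p x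
replicate-x-+ zero p = refl
replicate-x-+ (suc n) p = cong (x ∷_) (replicate-x-+ n p)

zW-+1 : ∀ n → zW (n + 1) ≡ replicate n x ++ [ y ]
zW-+1 n = cong zW (NP.+-comm n 1)

xCuts-z-shifted : ∀ m q c (F : Word → ℚ) →
  xCuts (zW (suc m)) (λ w₁ w₂ → F (w₁ ++ (c ++ (replicate q x ++ w₂))))
  ≡ Σ∈ (map suc (upTo m)) (λ i → F (zW (suc m ∸ i + 1) ++ (c ++ zW (q + i))))
xCuts-z-shifted zero q c F = refl
xCuts-z-shifted (suc m) q c F = begin
  F ((x ∷ replicate m x ++ [ y ]) ++ (c ++ (replicate q x ++ [ y ]))) Q.+
  xCuts (replicate m x ++ [ y ]) (λ w₁ w₂ → F (w₁ ++ (c ++ (replicate q x ++ (x ∷ w₂)))))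
    ≡⟨ cong₂ Q._+_ (cong₂ (λ a b → F (a ++ (c ++ b))) (sym (zW-+1 (suc m))) (sym (zW-+1 q)))
         (trans (xCuts-cong (replicate m x ++ [ y ]) (λ w₁ w₂ → cong (λ t → F (w₁ ++ (c ++ t))) (replicate-x-∷ q w₂)))
                (xCuts-z-shifted m (suc q) c F)) ⟩
  G 1 Q.+ Σ∈ (map suc (upTo m)) G′
    ≡⟨ cong (G 1 Q.+_) reindex ⟩
  G 1 Q.+ Σ∈ (map suc (applyUpTo suc m)) G ∎
  where
  G G′ : ℕ → ℚ
  G i = F (zW (suc (suc m) ∸ i + 1) ++ (c ++ zW (q + i)))
  G′ i = F (zW (suc m ∸ i + 1) ++ (c ++ zW (suc q + i)))
  reindex : Σ∈ (map suc (upTo m)) G′ ≡ Σ∈ (map suc (applyUpTo suc m)) G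
  reindex = begin
    Σ∈ (map suc (upTo m)) G′           ≡⟨ Σ∈-map suc (upTo m) G′ ⟩
    Σ∈ (upTo m) (G′ ∘ suc)             ≡⟨ Σ∈-applyUpTo id m (G′ ∘ suc) ⟩
    Σ< m (G′ ∘ suc)                    ≡⟨ Σ<-cong m (λ i _ → cong (λ t → F (zW (m ∸ i + 1) ++ (c ++ zW t)))
                                                                 (sym (NP.+-suc q (suc i)))) ⟩
    Σ< m (G ∘ suc ∘ suc)               ≡⟨ sym (Σ∈-applyUpTo suc m (G ∘ suc)) ⟩
    Σ∈ (applyUpTo suc m) (G ∘ suc)     ≡⟨ sym (Σ∈-map suc (applyUpTo suc m) G) ⟩
    Σ∈ (map suc (applyUpTo suc m)) G ∎

xCuts-z : ∀ k → .{{NonZero k}} → ∀ c (F : Word → ℚ) →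
  xCuts (zW k) (λ w₁ w₂ → F (w₁ ++ (c ++ w₂))) ≡ Σ∈ (map suc (upTo (k ∸ 1))) (λ i → F (zW (k ∸ i + 1) ++ (c ++ zW i)))
xCuts-z (suc m) c F = xCuts-z-shifted m 0 c F

xCuts-xⁿ : ∀ n p (F : Word → ℚ) →
  xCuts (replicate n x) (λ w₁ w₂ → F (w₁ ++ (replicate p x ++ w₂))) ≡ fromℕ n Q.* F (replicate (n + p) x ++ [ y ])
xCuts-xⁿ zero p F = sym (QP.*-zeroˡ (F (replicate p x ++ [ y ])))
xCuts-xⁿ (suc n) p F = begin
  F ((x ∷ replicate n x) ++ (replicate p x ++ [ y ])) Q.+
  xCuts (replicate n x) (λ w₁ w₂ → F (w₁ ++ (replicate p x ++ (x ∷ w₂))))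
    ≡⟨ cong₂ Q._+_ (cong F regroup)
         (trans (xCuts-cong (replicate n x) (λ w₁ w₂ → cong (λ t → F (w₁ ++ t)) (replicate-x-∷ p w₂)))
                (xCuts-xⁿ n (suc p) F)) ⟩
  F W Q.+ fromℕ n Q.* F (replicate (n + suc p) x ++ [ y ])
    ≡⟨ cong (λ t → F W Q.+ fromℕ n Q.* F (replicate t x ++ [ y ])) (NP.+-suc n p) ⟩
  F W Q.+ fromℕ n Q.* F W
    ≡⟨ a+na≡[1+n]a (F W) (fromℕ n) ⟩
  (1ℚ Q.+ fromℕ n) Q.* F W
    ≡⟨ cong (Q._* F W) (sym (fromℕ-+ 1 n)) ⟩
  fromℕ (suc n) Q.* F W ∎
  where
  W : Word
  W = replicate (suc n + p) x ++ [ y ]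
  regroup : (x ∷ replicate n x) ++ (replicate p x ++ [ y ]) ≡ W
  regroup = trans (sym (++-assoc (x ∷ replicate n x) (replicate p x) [ y ])) (cong (_++ [ y ]) (sym (replicate-x-+ (suc n) p)))
  a+na≡[1+n]a : ∀ a b → a Q.+ b Q.* a ≡ (1ℚ Q.+ b) Q.* a
  a+na≡[1+n]a = solve-∀ ℚ-ring

aroundγ-rotate : ∀ κ F i pre suf →
  aroundγ κ (ρ0αᵀ F) i pre suf ≡ ⟪ γW (suf ++ pre) ∣ (λ v → ρ0αᵀ F (v ++ zW (κ i))) ⟫
aroundγ-rotate κ F i pre suf = begin
  aroundγ κ (ρ0αᵀ F) i pre suf
    ≡⟨ pair-swap (γW pre) (γW suf) (λ u₁ u₂ → ρ0αᵀ F (u₁ ++ (B ++ u₂))) ⟩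
  ⟪ γW suf ∣ (λ u₂ → ⟪ γW pre ∣ (λ u₁ → ρ0αᵀ F (u₁ ++ (B ++ u₂))) ⟫) ⟫
    ≡⟨ pair-cong (γW suf) (λ u₂ → pair-cong (γW pre) (λ u₁ → rotate u₁ u₂)) ⟩
  ⟪ γW suf ∣ (λ u₂ → ⟪ γW pre ∣ (λ u₁ → ρ0αᵀ F ((u₂ ++ u₁) ++ B)) ⟫) ⟫
    ≡⟨ sym (pair-liftW-++ γL suf pre (λ v → ρ0αᵀ F (v ++ B))) ⟩
  ⟪ γW (suf ++ pre) ∣ (λ v → ρ0αᵀ F (v ++ B)) ⟫ ∎
  where
  B : Word
  B = zW (κ i)
  rotate : ∀ u₁ u₂ → ρ0αᵀ F (u₁ ++ (B ++ u₂)) ≡ ρ0αᵀ F ((u₂ ++ u₁) ++ B)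
  rotate u₁ u₂ = begin
    ρ0αᵀ F (u₁ ++ (B ++ u₂))   ≡⟨ cong (ρ0αᵀ F) (sym (++-assoc u₁ B u₂)) ⟩
    ρ0αᵀ F ((u₁ ++ B) ++ u₂)   ≡⟨ ρ0αᵀ-rotate F (u₁ ++ B) u₂ ⟩
    ρ0αᵀ F (u₂ ++ (u₁ ++ B))   ≡⟨ cong (ρ0αᵀ F) (sym (++-assoc u₂ u₁ B)) ⟩
    ρ0αᵀ F ((u₂ ++ u₁) ++ B) ∎

module CyclicWord (l′ : ℕ) (κ : ℕ → ℕ) (κ≢0 : ∀ n → NonZero (κ n))
                  (periodic : ∀ n → κ (n + suc l′) ≡ κ n) where

  l : ℕ
  l = suc l′

  W : Word
  W = zs κ 0 l

  lhs : Poly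
  lhs = Σ[ upTo l ] (λ j → ρ0 (α (d (word (zs κ j l)))))

  cutWords : ℕ → Poly
  cutWords j = Σ[ map suc (upTo (κ j ∸ 1)) ] (λ i → word (zW (κ j ∸ i + 1) ++ zs κ (suc j) l′ ++ zW i))

  cuts : Poly
  cuts = Σ[ upTo l ] cutWords

  rhs : ℕ → Poly
  rhs K = cuts +P scale (- fromℕ K) (word (zW (K + 1)))

  module _ (F : Word → ℚ) where

    H : Word → Word → ℚ
    H w₁ w₂ = F (w₁ ++ w₂)

    rotationTerm cutTerm : ℕ → ℚ
    rotationTerm j = ⟪ γW (zs κ j l′) ∣ (λ v → ρ0αᵀ F (v ++ zW (κ (j + l′)))) ⟫
    cutTerm j = Σ∈ (map suc (upTo (κ j ∸ 1))) (λ i → F (zW (κ j ∸ i + 1) ++ zs κ (suc j) l′ ++ zW i))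

    pair-ρ0αd-rotation : ∀ j → ⟪ ρ0 (α (d (word (zs κ j l)))) ∣ F ⟫ ≡ rotationTerm j
    pair-ρ0αd-rotation j = begin
      ⟪ ρ0 (α (d (word (zs κ j l)))) ∣ F ⟫      ≡⟨ pair-ρ0 (α (d (word (zs κ j l)))) F ⟩
      ⟪ α (d (word (zs κ j l))) ∣ ρ0ᵀ F ⟫       ≡⟨ pair-α (d (word (zs κ j l))) (ρ0ᵀ F) ⟩
      ⟪ d (word (zs κ j l)) ∣ ρ0αᵀ F ⟫          ≡⟨ pair-d-word (zs κ j l) (ρ0αᵀ F) ⟩
      ⟪ dW (zs κ j l) ∣ ρ0αᵀ F ⟫                ≡⟨ cong (λ w → ⟪ dW w ∣ ρ0αᵀ F ⟫) (zs-∷ʳ κ j l′) ⟩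
      ⟪ dW (zs κ j l′ ++ zW (κ (j + l′))) ∣ ρ0αᵀ F ⟫
        ≡⟨ pair-dW-z (zs κ j l′) (κ (j + l′)) {{κ≢0 (j + l′)}} (ρ0αᵀ F) ⟩
      rotationTerm j ∎

    rotate-around : ∀ i → i ℕ.< l → zs κ (suc i) (l ∸ suc i) ++ zs κ 0 i ≡ zs κ (suc i) l′
    rotate-around i i<l = sym (begin
      zs κ (suc i) l′                                     ≡⟨ cong (zs κ (suc i)) (sym (NP.m∸n+n≡m i≤l′)) ⟩
      zs κ (suc i) (l′ ∸ i + i)                           ≡⟨ zs-+ κ (suc i) (l′ ∸ i) i ⟩
      zs κ (suc i) (l′ ∸ i) ++ zs κ (suc i + (l′ ∸ i)) i  ≡⟨ cong (λ b → zs κ (suc i) (l′ ∸ i) ++ zs κ b i)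
                                                                   (cong suc (NP.m+[n∸m]≡n i≤l′)) ⟩
      zs κ (suc i) (l′ ∸ i) ++ zs κ (0 + l) i             ≡⟨ cong (zs κ (suc i) (l′ ∸ i) ++_) (zs-periodic κ l periodic 0 i) ⟩
      zs κ (suc i) (l′ ∸ i) ++ zs κ 0 i ∎)
      where
      i≤l′ : i ≤ l′
      i≤l′ = ℕ.s≤s⁻¹ i<l

    last-block : ∀ i → κ i ≡ κ (suc i + l′)
    last-block i = sym (trans (cong κ (sym (NP.+-suc i l′))) (periodic i))

    Σ-rotationTerm : Σ< l rotationTerm ≡ ⟪ γW W ∣ (λ u → fromℕ (depth u) Q.* ρ0αᵀ F u) ⟫
    Σ-rotationTerm = begin
      Σ< l rotationTerm
        ≡⟨ sym (Σ<-shift l rotationTerm wraps-around) ⟩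
      Σ< l (rotationTerm ∘ suc)
        ≡⟨ Σ<-cong l (λ i i<l → sym (trans (aroundγ-rotate κ F i (zs κ 0 i) (zs κ (suc i) (l ∸ suc i)))
             (cong₂ (λ w b → ⟪ γW w ∣ (λ v → ρ0αᵀ F (v ++ zW b)) ⟫) (rotate-around i i<l) (last-block i)))) ⟩
      Σ< l (λ i → aroundγ κ (ρ0αᵀ F) i (zs κ 0 i) (zs κ (suc i) (l ∸ suc i)))
        ≡⟨ sym (Σfocus≡Σ< κ 0 l (aroundγ κ (ρ0αᵀ F))) ⟩
      Σfocus κ 0 l (aroundγ κ (ρ0αᵀ F))
        ≡⟨ sym (pair-γ-depth-zs κ κ≢0 0 l (ρ0αᵀ F)) ⟩
      ⟪ γW W ∣ (λ u → fromℕ (depth u) Q.* ρ0αᵀ F u) ⟫ ∎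
      where
      wraps-around : rotationTerm l ≡ rotationTerm 0
      wraps-around = cong₂ (λ w b → ⟪ γW w ∣ (λ v → ρ0αᵀ F (v ++ zW b)) ⟫)
        (zs-periodic κ l periodic 0 l′) (trans (cong κ (NP.+-comm l l′)) (periodic l′))

    pair-γ-depth-ρ0α : ⟪ γW W ∣ (λ u → fromℕ (depth u) Q.* ρ0αᵀ F u) ⟫
                   ≡ xCuts W H Q.+ Q.- fromℕ (length W) Q.* F (zW (length W + 1))
    pair-γ-depth-ρ0α = begin
      ⟪ γW W ∣ (λ u → fromℕ (depth u) Q.* ρ0αᵀ F u) ⟫
        ≡⟨ pair-cong (γW W) (λ u → depth*invDepth u (ρ0ᵀ F u)) ⟩
      ⟪ γW W ∣ (λ u → ρ0ᵀ F u Q.+ Q.- 1ℚ Q.* (depthZero u Q.* ρ0ᵀ F u)) ⟫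
        ≡⟨ pair-+ (γW W) _ _ ⟩
      ⟪ γW W ∣ ρ0ᵀ F ⟫ Q.+ ⟪ γW W ∣ (λ u → Q.- 1ℚ Q.* (depthZero u Q.* ρ0ᵀ F u)) ⟫
        ≡⟨ cong₂ Q._+_ (pair-γ-C̄₀ W H) (trans (pair-* (γW W) (Q.- 1ℚ) _)
                                              (cong (Q.- 1ℚ Q.*_) (pair-γ-depthZero W (ρ0ᵀ F)))) ⟩
      xCuts W H Q.+ Q.- 1ℚ Q.* ρ0ᵀ F (replicate K x)
        ≡⟨ cong (λ t → xCuts W H Q.+ Q.- 1ℚ Q.* t) ρ0ᵀ-xᴷ ⟩
      xCuts W H Q.+ Q.- 1ℚ Q.* (fromℕ K Q.* F (replicate (K + 0) x ++ [ y ]))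
        ≡⟨ cong (xCuts W H Q.+_) (trans (-1*[ab]≡-a*b (fromℕ K) _)
             (cong (λ t → Q.- fromℕ K Q.* F (replicate t x ++ [ y ])) (NP.+-identityʳ K))) ⟩
      xCuts W H Q.+ Q.- fromℕ K Q.* F (replicate K x ++ [ y ])
        ≡⟨ cong (λ w → xCuts W H Q.+ Q.- fromℕ K Q.* F w) (sym (zW-+1 K)) ⟩
      xCuts W H Q.+ Q.- fromℕ K Q.* F (zW (K + 1)) ∎
      where
      K : ℕ
      K = length W
      ρ0ᵀ-xᴷ : ρ0ᵀ F (replicate K x) ≡ fromℕ K Q.* F (replicate (K + 0) x ++ [ y ])
      ρ0ᵀ-xᴷ = trans (sym (pair-γ-xⁿ K (λ t → ⟪C̄₀ t ∣ H ⟫))) (trans (pair-γ-C̄₀ (replicate K x) H) (xCuts-xⁿ K 0 F))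
      -1*[ab]≡-a*b : ∀ a b → Q.- 1ℚ Q.* (a Q.* b) ≡ Q.- a Q.* b
      -1*[ab]≡-a*b = solve-∀ ℚ-ring

    xCuts-W : xCuts W H ≡ Σ< l cutTerm
    xCuts-W = begin
      xCuts W H                                   ≡⟨ xCuts-zs κ 0 l H ⟩
      Σfocus κ 0 l (aroundCuts κ H)               ≡⟨ Σfocus≡Σ< κ 0 l (aroundCuts κ H) ⟩
      Σ< l (λ i → aroundCuts κ H i (zs κ 0 i) (zs κ (suc i) (l ∸ suc i)))
        ≡⟨ Σ<-cong l block-cuts ⟩
      Σ< l cutTerm ∎
      where
      block-cuts : ∀ i → i ℕ.< l → aroundCuts κ H i (zs κ 0 i) (zs κ (suc i) (l ∸ suc i)) ≡ cutTerm i
      block-cuts i i<l = begin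
        xCuts (zW (κ i)) (λ w₁ w₂ → F ((w₁ ++ suf) ++ (pre ++ w₂)))
          ≡⟨ xCuts-cong (zW (κ i)) (λ w₁ w₂ → cong F (trans (++-assoc w₁ suf (pre ++ w₂))
                                                            (cong (w₁ ++_) (sym (++-assoc suf pre w₂))))) ⟩
        xCuts (zW (κ i)) (λ w₁ w₂ → F (w₁ ++ ((suf ++ pre) ++ w₂)))
          ≡⟨ xCuts-z (κ i) {{κ≢0 i}} (suf ++ pre) F ⟩
        Σ∈ (map suc (upTo (κ i ∸ 1))) (λ j → F (zW (κ i ∸ j + 1) ++ ((suf ++ pre) ++ zW j)))
          ≡⟨ Σ∈-cong (map suc (upTo (κ i ∸ 1))) (λ j → cong (λ c → F (zW (κ i ∸ j + 1) ++ (c ++ zW j)))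
                                                              (rotate-around i i<l)) ⟩
        cutTerm i ∎
        where
        pre suf : Word
        pre = zs κ 0 i
        suf = zs κ (suc i) (l ∸ suc i)

    pair-cyclic-sum : ⟪ lhs ∣ F ⟫
                    ≡ Σ< l cutTerm Q.+ Q.- fromℕ (length W) Q.* F (zW (length W + 1))
    pair-cyclic-sum = begin
      ⟪ Σ[ upTo l ] (λ j → ρ0 (α (d (word (zs κ j l))))) ∣ F ⟫
        ≡⟨ pair-concatMap (λ j → ρ0 (α (d (word (zs κ j l))))) (upTo l) F ⟩
      Σ∈ (upTo l) (λ j → ⟪ ρ0 (α (d (word (zs κ j l)))) ∣ F ⟫)
        ≡⟨ trans (Σ∈-cong (upTo l) pair-ρ0αd-rotation) (Σ∈-applyUpTo id l rotationTerm) ⟩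
      Σ< l rotationTerm
        ≡⟨ Σ-rotationTerm ⟩
      ⟪ γW W ∣ (λ u → fromℕ (depth u) Q.* ρ0αᵀ F u) ⟫
        ≡⟨ pair-γ-depth-ρ0α ⟩
      xCuts W H Q.+ Q.- fromℕ (length W) Q.* F (zW (length W + 1))
        ≡⟨ cong (Q._+ Q.- fromℕ (length W) Q.* F (zW (length W + 1))) xCuts-W ⟩
      Σ< l cutTerm Q.+ Q.- fromℕ (length W) Q.* F (zW (length W + 1)) ∎

    pair-cut-sum : ∀ K → ⟪ rhs K ∣ F ⟫ ≡ Σ< l cutTerm Q.+ Q.- fromℕ K Q.* F (zW (K + 1))
    pair-cut-sum K = trans (pair-++ cuts _ F) (cong₂ Q._+_ pair-cuts pair-correction)
      where
      pair-cuts : ⟪ cuts ∣ F ⟫ ≡ Σ< l cutTerm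
      pair-cuts = begin
        ⟪ cuts ∣ F ⟫                          ≡⟨ pair-concatMap cutWords (upTo l) F ⟩
        Σ∈ (upTo l) (λ j → ⟪ cutWords j ∣ F ⟫) ≡⟨ Σ∈-cong (upTo l) (λ j →
                                                    trans (pair-concatMap _ (map suc (upTo (κ j ∸ 1))) F)
                                                          (Σ∈-cong (map suc (upTo (κ j ∸ 1))) (λ i → pair-word _ F))) ⟩
        Σ∈ (upTo l) cutTerm                   ≡⟨ Σ∈-applyUpTo id l cutTerm ⟩
        Σ< l cutTerm ∎
      pair-correction : ⟪ scale (- fromℕ K) (word (zW (K + 1))) ∣ F ⟫ ≡ Q.- fromℕ K Q.* F (zW (K + 1))
      pair-correction = trans (pair-scale (- fromℕ K) (word (zW (K + 1))) F) (cong (Q.- fromℕ K Q.*_) (pair-word _ F))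

  cyclic-identity : ∀ K → length W ≡ K → lhs ≈P rhs K
  cyclic-identity K |W|≡K = ≈P-by-pairing {lhs} {rhs K} λ F → begin
    ⟪ lhs ∣ F ⟫
      ≡⟨ pair-cyclic-sum F ⟩
    Σ< l (cutTerm F) Q.+ Q.- fromℕ (length W) Q.* F (zW (length W + 1))
      ≡⟨ cong (λ n → Σ< l (cutTerm F) Q.+ Q.- fromℕ n Q.* F (zW (n + 1))) |W|≡K ⟩
    Σ< l (cutTerm F) Q.+ Q.- fromℕ K Q.* F (zW (K + 1))
      ≡⟨ sym (pair-cut-sum F K) ⟩
    ⟪ rhs K ∣ F ⟫ ∎

proposition6p9 : (l : ℕ) .{{_ : NonZero l}} (k : Fin l → ℕ) → (∀ i → 1 ≤ k i) →
    let kc = cyc l k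
        K = sumFin l k
    in Σ[ upTo l ] (λ j → ρ0 (α (d (word (zs kc j l)))))
       ≈P Σ[ upTo l ] (λ j → Σ[ map suc (upTo (kc j ∸ 1)) ] (λ i →
              word (zW (kc j ∸ i + 1) ++ zs kc (suc j) (l ∸ 1) ++ zW i)))
          +P scale (- (+ K Data.Rational./ 1)) (word (zW (K + 1)))
proposition6p9 (suc l′) k 1≤k =
  CyclicWord.cyclic-identity l′ (cyc (suc l′) k) (λ _ → ℕ.>-nonZero (1≤k _)) (cyc-periodic (suc l′) k)
    (sumFin (suc l′) k) (length-zs-cyc (suc l′) k)
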